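{- Let $\mathcal{H}$ be a collection of nonempty loopless graphs, each with an even number of edges. Let $n,m\geqslant 2$ be integers with $n\geqslant 4^m$, and let $\mathcal{G}\subseteq\mathbb{F}_2^{\binom{[n]}{2}}$ be an $\mathcal{H}$-code with $\mathbb{P}[\mathcal{G}]=\delta_n(\mathcal{H})$. Then \[\big\|\widehat{(\mathbbm{1}_{\mathcal{G}}-\mathbb{P}[\mathcal{G}])}\big\|_{\ell_\infty}\leqslant \delta_m(\mathcal{H})-\delta_n(\mathcal{H}).\]
   Context: For a finite set $V$, $\binom{V}{2}$ is the set of 2-element subsets and $\binom{V}{\leqslant 2}$ the set of nonempty subsets with at most 2 elements; $[n]=\{1,\dots,n\}$. A graph on $V$ is a subset of $\binom{V}{\leqslant 2}$; 2-element members are edges, 1-element members self-loops; loopless means no self-loops. $V(G)$ is the union of the members of $G$. Graphs $G,H$ are isomorphic if there is a bijection $\phi\colon V(G)\to V(H)$ with $\{x,y\}\in G$ iff $\{\phi(x),\phi(y)\}\in H$ for all $x,y\in V(G)$. Loopless graphs on $[n]$ are identified with elements of $\mathbb{F}_2^{\binom{[n]}{2}}$; $G_1+G_2$ is the symmetric difference. A family $\mathcal{G}$ of graphs on a common vertex set is an $\mathcal{H}$-code if for all $G_1,G_2\in\mathcal{G}$, $G_1+G_2$ is not isomorphic to a graph in $\mathcal{H}$. $\mathbb{P}$ is the uniform probability measure on $\mathbb{F}_2^{\binom{[n]}{2}}$, and $\delta_n(\mathcal{H})$ is the maximum of $\mathbb{P}[\mathcal{G}]$ over $\mathcal{H}$-codes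 $\mathcal{G}\subseteq\mathbb{F}_2^{\binom{[n]}{2}}$. For $f\colon\mathbb{F}_2^{\mathcal{I}}\to\mathbb{C}$, $\widehat f(\xi)=\mathbb{E}_x[f(x)(-1)^{|x\cap\xi|}]$ (uniform expectation) and $\|\widehat f\|_{\ell_\infty}=\max_\xi|\widehat f(\xi)|$. -}

module Defs where

open import Data.Bool using (Bool; true; false; if_then_else_; _xor_; _∧_)
open import Data.Unit using (⊤; tt)
open import Data.Product using (Σ; ∃; ∃-syntax; _×_; _,_)
open import Data.Nat using (ℕ; zero; suc; _+_; _^_; _<_)
open import Data.Nat.Properties using (m^n≢0)
open import Data.Nat.Divisibility using (_∣_)
open import Data.Nat.Combinatorics using (_C_)
open import Data.Fin using (Fin; zero; suc)
open import Data.Vec using (Vec; lookup; zipWith) renaming ([] to []ᵥ; _∷_ to _∷ᵥ_)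
open import Data.List using (List; []; _∷_; concatMap; map; foldr)
open import Data.Integer using (+_)
open import Data.Rational using (ℚ; 0ℚ; 1ℚ; -_; _/_) renaming (_+_ to _+ℚ_; _*_ to _*ℚ_)
open import Relation.Binary.PropositionalEquality using (_≡_)

-- Loopless graphs on [n] = Fin n, i.e. elements of F₂^(binom [n] 2).
-- A graph on Fin (suc n) is a graph on the vertices 1..n (as Fin n via suc)
-- together with the adjacency row of vertex 0 to those n vertices.

Graph : ℕ → Set
Graph zero    = ⊤
Graph (suc n) = Graph n × Vec Bool n

adj : ∀ {n} → Graph n → Fin n → Fin n → Bool
adj {suc n} (g , r) zero    zero    = false
adj {suc n} (g , r) zero    (suc j) = lookup r j
adj {suc n} (g , r) (suc i) zero    = lookup r i
adj {suc n} (g , r) (suc i) (suc j) = adj g i j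

zipG : (Bool → Bool → Bool) → ∀ {n} → Graph n → Graph n → Graph n
zipG f {zero}  _       _        = tt
zipG f {suc n} (g , r) (h , s) = zipG f g h , zipWith f r s

_+G_ : ∀ {n} → Graph n → Graph n → Graph n
_+G_ = zipG _xor_

_∩G_ : ∀ {n} → Graph n → Graph n → Graph n
_∩G_ = zipG _∧_

countVec : ∀ {k} → Vec Bool k → ℕ
countVec []ᵥ          = 0
countVec (true ∷ᵥ v)  = suc (countVec v)
countVec (false ∷ᵥ v) = countVec v

edgeCount : ∀ {n} → Graph n → ℕ
edgeCount {zero}  _       = 0
edgeCount {suc n} (g , r) = edgeCount g + countVec r

allVecs : ∀ k → List (Vec Bool k)
allVecs zero    = []ᵥ ∷ []
allVecs (suc k) = concatMap (λ v → (true ∷ᵥ v) ∷ (false ∷ᵥ v) ∷ []) (allVecs k)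

allGraphs : ∀ n → List (Graph n)
allGraphs zero    = tt ∷ []
allGraphs (suc n) = concatMap (λ g → map (λ r → g , r) (allVecs n)) (allGraphs n)

-- Isomorphism, with V(G) = set of vertices incident to an edge of G
-- (G loopless, so V(G) is the union of its edges).

InV : ∀ {n} → Graph n → Fin n → Set
InV G v = ∃[ u ] adj G v u ≡ true

Iso : ∀ {n k} → Graph n → Graph k → Set
Iso {n} {k} G H =
  Σ (Fin n → Fin k) λ φ → Σ (Fin k → Fin n) λ ψ →
    (∀ v → InV G v → InV H (φ v) × ψ (φ v) ≡ v) ×
    (∀ w → InV H w → InV G (ψ w) × φ (ψ w) ≡ w) ×
    (∀ x y → InV G x → InV G y → adj G x y ≡ adj H (φ x) (φ y))

-- A collection 𝓗 of loopless graphs: every finite loopless graph is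
-- isomorphic to one on some Fin k, so 𝓗 is a predicate on such graphs.
GraphClass : Set₁
GraphClass = (k : ℕ) → Graph k → Set

IsoToMember : GraphClass → ∀ {n} → Graph n → Set
IsoToMember 𝓗 G = ∃[ k ] Σ (Graph k) λ H → 𝓗 k H × Iso G H

Family : ℕ → Set
Family n = Graph n → Bool

IsCode : GraphClass → ∀ {n} → Family n → Set
IsCode 𝓗 {n} 𝒢 = ∀ (G₁ G₂ : Graph n) → 𝒢 G₁ ≡ true → 𝒢 G₂ ≡ true →
  IsoToMember 𝓗 (G₁ +G G₂) → Data.Empty.⊥
  where import Data.Empty

sumℚ : List ℚ → ℚ
sumℚ = foldr _+ℚ_ 0ℚ

invSize : ℕ → ℚ
invSize n = _/_ (+ 1) (2 ^ (n C 2)) {{m^n≢0 2 (n C 2)}}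

𝔼 : ∀ {n} → (Graph n → ℚ) → ℚ
𝔼 {n} f = sumℚ (map f (allGraphs n)) *ℚ invSize n

indicator : ∀ {n} → Family n → Graph n → ℚ
indicator 𝒢 x = if 𝒢 x then 1ℚ else 0ℚ

ℙ : ∀ {n} → Family n → ℚ
ℙ 𝒢 = 𝔼 (indicator 𝒢)

sign : ℕ → ℚ
sign zero    = 1ℚ
sign (suc k) = - sign k

fourier : ∀ {n} → (Graph n → ℚ) → Graph n → ℚ
fourier f ξ = 𝔼 (λ x → f x *ℚ sign (edgeCount (x ∩G ξ)))

-- 𝒢 attains δₙ(𝓗): it is an 𝓗-code of maximum probability among 𝓗-codes.
-- (So δₙ(𝓗) = ℙ[𝒢] for any such 𝒢.)
IsOptimalCode : GraphClass → ∀ n → Family n → Set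
IsOptimalCode 𝓗 n 𝒢 = IsCode 𝓗 𝒢 × (∀ (𝒢′ : Family n) → IsCode 𝓗 𝒢′ → ℙ 𝒢′ Data.Rational.≤ ℙ 𝒢)
  where import Data.Rational

module Submission where

-- For ξ ≠ ∅ the Fourier coefficient of 𝟙_𝒢 - ℙ𝒢 at ξ is ℙ𝒢₀ - ℙ𝒢₁, where 𝒢_b is the part of 𝒢 on
-- the hyperplane x · ξ = b (x · ξ = |x ∩ ξ| mod 2), and ℙ𝒢 = ℙ𝒢₀ + ℙ𝒢₁; since |a - b| ≤ t - (a + b)
-- whenever 2a, 2b ≤ t, it suffices to show 2 ℙ𝒢_b ≤ δₘ.  As n ≥ 4^m, Ramsey's theorem gives m vertices
-- spanning a clique or an independent set of ξ, and averaging over the slices x + (graphs on these m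
-- vertices) turns the code 𝒢 on [n] into codes on [m].  On a clique, z · ξ = |z| mod 2 for z inside,
-- so every slice of 𝒢_b has constant edge parity and its union with its shift by a single edge is
-- again a code, twice as large: the new differences have an odd number of edges, while members of 𝓗
-- have an even number.  On an independent set, every slice of 𝒢_b is a slice of 𝒢 or empty, and only
-- half of the x lie on the hyperplane.  For ξ = ∅ the coefficient vanishes and the claim is δₙ ≤ δₘ,
-- which is the same averaging argument.

open import Defs
open import Data.Bool using (Bool; true; false; not; _xor_; _∧_; _∨_; if_then_else_)
open import Data.Empty using (⊥)
open import Data.Nat using (ℕ; zero; suc)
open import Data.Nat.Divisibility using (_∣_)
open import Data.Product using (Σ; ∃-syntax; ∃₂; _×_; _,_; proj₁; proj₂)
open import Data.Sum using (_⊎_; inj₁; inj₂; [_,_]′)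
open import Data.Fin using (Fin; zero; suc)
open import Data.Unit using (tt)
open import Relation.Nullary using (¬_; yes; no; does; contradiction)
open import Relation.Binary.PropositionalEquality

module GraphAlgebra where

  open import Data.Bool.Properties
    using (xor-assoc; xor-comm; xor-identityʳ; xor-same; ∧-distribʳ-xor; ∧-zeroʳ; ∧-zeroˡ)
  open import Data.Nat using (_+_)
  open import Data.Vec using (zipWith; tabulate; replicate)
  open import Data.Vec.Properties
    using (zipWith-assoc; zipWith-comm; zipWith-identityʳ; zipWith-inverseʳ; zipWith-distribʳ;
           zipWith-zeroʳ; zipWith-zeroˡ; map-id; lookup-zipWith; lookup-replicate;
           tabulate∘lookup; tabulate-cong; lookup∘tabulate)
  open ≡-Reasoning

  emptyG : ∀ {n} → Graph n
  emptyG {zero}  = tt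
  emptyG {suc n} = emptyG , replicate n false

  +G-assoc : ∀ {n} (G H K : Graph n) → (G +G H) +G K ≡ G +G (H +G K)
  +G-assoc {zero}  _       _       _       = refl
  +G-assoc {suc n} (g , r) (h , s) (k , t) = cong₂ _,_ (+G-assoc g h k) (zipWith-assoc xor-assoc r s t)

  +G-comm : ∀ {n} (G H : Graph n) → G +G H ≡ H +G G
  +G-comm {zero}  _       _       = refl
  +G-comm {suc n} (g , r) (h , s) = cong₂ _,_ (+G-comm g h) (zipWith-comm xor-comm r s)

  +G-identityʳ : ∀ {n} (G : Graph n) → G +G emptyG ≡ G
  +G-identityʳ {zero}  _       = refl
  +G-identityʳ {suc n} (g , r) = cong₂ _,_ (+G-identityʳ g) (zipWith-identityʳ xor-identityʳ r)

  +G-self : ∀ {n} (G : Graph n) → G +G G ≡ emptyG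
  +G-self {zero}  _       = refl
  +G-self {suc n} (g , r) =
    cong₂ _,_ (+G-self g) (trans (cong (zipWith _xor_ r) (sym (map-id r))) (zipWith-inverseʳ xor-same r))

  [G+K]+[H+K]≡G+H : ∀ {n} (G H K : Graph n) → (G +G K) +G (H +G K) ≡ G +G H
  [G+K]+[H+K]≡G+H G H K = begin
    (G +G K) +G (H +G K)  ≡⟨ +G-assoc G K (H +G K) ⟩
    G +G (K +G (H +G K))  ≡⟨ cong (G +G_) (sym (+G-assoc K H K)) ⟩
    G +G ((K +G H) +G K)  ≡⟨ cong (λ X → G +G (X +G K)) (+G-comm K H) ⟩
    G +G ((H +G K) +G K)  ≡⟨ cong (G +G_) (+G-assoc H K K) ⟩
    G +G (H +G (K +G K))  ≡⟨ cong (λ X → G +G (H +G X)) (+G-self K) ⟩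
    G +G (H +G emptyG)    ≡⟨ cong (G +G_) (+G-identityʳ H) ⟩
    G +G H                ∎

  ∩G-distribʳ-+G : ∀ {n} (G H K : Graph n) → (G +G H) ∩G K ≡ (G ∩G K) +G (H ∩G K)
  ∩G-distribʳ-+G {zero}  _       _       _       = refl
  ∩G-distribʳ-+G {suc n} (g , r) (h , s) (k , t) =
    cong₂ _,_ (∩G-distribʳ-+G g h k) (zipWith-distribʳ ∧-distribʳ-xor t r s)

  ∩G-zeroˡ : ∀ {n} (G : Graph n) → emptyG ∩G G ≡ emptyG
  ∩G-zeroˡ {zero}  _       = refl
  ∩G-zeroˡ {suc n} (g , r) = cong₂ _,_ (∩G-zeroˡ g) (zipWith-zeroˡ ∧-zeroˡ r)

  ∩G-zeroʳ : ∀ {n} (G : Graph n) → G ∩G emptyG ≡ emptyG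
  ∩G-zeroʳ {zero}  _       = refl
  ∩G-zeroʳ {suc n} (g , r) = cong₂ _,_ (∩G-zeroʳ g) (zipWith-zeroʳ ∧-zeroʳ r)

  countVec-replicate : ∀ k → countVec (replicate k false) ≡ 0
  countVec-replicate zero    = refl
  countVec-replicate (suc k) = countVec-replicate k

  edgeCount-emptyG : ∀ n → edgeCount (emptyG {n}) ≡ 0
  edgeCount-emptyG zero    = refl
  edgeCount-emptyG (suc n) = cong₂ _+_ (edgeCount-emptyG n) (countVec-replicate n)

  adj-zipG : (f : Bool → Bool → Bool) → f false false ≡ false →
             ∀ {n} (G H : Graph n) i j → adj (zipG f G H) i j ≡ f (adj G i j) (adj H i j)
  adj-zipG f f00 {suc n} _       _       zero    zero    = sym f00
  adj-zipG f f00 {suc n} (_ , r) (_ , s) zero    (suc j) = lookup-zipWith f j r s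
  adj-zipG f f00 {suc n} (_ , r) (_ , s) (suc i) zero    = lookup-zipWith f i r s
  adj-zipG f f00 {suc n} (g , _) (h , _) (suc i) (suc j) = adj-zipG f f00 g h i j

  adj-+G : ∀ {n} (G H : Graph n) i j → adj (G +G H) i j ≡ adj G i j xor adj H i j
  adj-+G = adj-zipG _xor_ refl

  adj-∩G : ∀ {n} (G H : Graph n) i j → adj (G ∩G H) i j ≡ adj G i j ∧ adj H i j
  adj-∩G = adj-zipG _∧_ refl

  adj-emptyG : ∀ {n} (i j : Fin n) → adj (emptyG {n}) i j ≡ false
  adj-emptyG {suc n} zero    zero    = refl
  adj-emptyG {suc n} zero    (suc j) = lookup-replicate j false
  adj-emptyG {suc n} (suc i) zero    = lookup-replicate i false
  adj-emptyG {suc n} (suc i) (suc j) = adj-emptyG i j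

  adj-irrefl : ∀ {n} (G : Graph n) i → adj G i i ≡ false
  adj-irrefl {suc n} _       zero    = refl
  adj-irrefl {suc n} (g , _) (suc i) = adj-irrefl g i

  adj-sym : ∀ {n} (G : Graph n) i j → adj G i j ≡ adj G j i
  adj-sym {suc n} _       zero    zero    = refl
  adj-sym {suc n} _       zero    (suc j) = refl
  adj-sym {suc n} _       (suc i) zero    = refl
  adj-sym {suc n} (g , _) (suc i) (suc j) = adj-sym g i j

  adj-ext : ∀ {n} (G H : Graph n) → (∀ i j → adj G i j ≡ adj H i j) → G ≡ H
  adj-ext {zero}  _       _       _  = refl
  adj-ext {suc n} (g , r) (h , s) eq = cong₂ _,_ (adj-ext g h (λ i j → eq (suc i) (suc j))) row
    where
    row : r ≡ s
    row = trans (sym (tabulate∘lookup r)) (trans (tabulate-cong (λ j → eq zero (suc j))) (tabulate∘lookup s))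

  fromAdj : ∀ {n} → (Fin n → Fin n → Bool) → Graph n
  fromAdj {zero}  f = tt
  fromAdj {suc n} f = fromAdj (λ i j → f (suc i) (suc j)) , tabulate (λ j → f zero (suc j))

  adj-fromAdj : ∀ {n} (f : Fin n → Fin n → Bool) → (∀ i j → f i j ≡ f j i) → (∀ i → f i i ≡ false) →
                ∀ i j → adj (fromAdj f) i j ≡ f i j
  adj-fromAdj {suc n} f f-sym f-irrefl zero    zero    = sym (f-irrefl zero)
  adj-fromAdj {suc n} f f-sym f-irrefl zero    (suc j) = lookup∘tabulate _ j
  adj-fromAdj {suc n} f f-sym f-irrefl (suc i) zero    = trans (lookup∘tabulate _ i) (f-sym zero (suc i))
  adj-fromAdj {suc n} f f-sym f-irrefl (suc i) (suc j) =
    adj-fromAdj (λ i j → f (suc i) (suc j)) (λ i j → f-sym (suc i) (suc j)) (λ i → f-irrefl (suc i)) i j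

open GraphAlgebra

module Parity where

  open import Algebra.Bundles using (CommutativeRing)
  open import Data.Bool.Properties using (not-distribˡ-xor; not-involutive; xor-comm; xor-∧-commutativeRing)
  open import Algebra.Properties.CommutativeSemigroup
    (CommutativeRing.+-commutativeSemigroup xor-∧-commutativeRing) using () renaming (interchange to xor-interchange)
  open import Data.Nat using (_+_; _*_)
  open import Data.Nat.Divisibility using (divides)
  open import Data.Vec using (Vec; zipWith; replicate) renaming ([] to []ᵥ; _∷_ to _∷ᵥ_)
  open ≡-Reasoning

  oddᵇ : ℕ → Bool
  oddᵇ zero    = false
  oddᵇ (suc k) = not (oddᵇ k)

  oddᵇ-+ : ∀ m n → oddᵇ (m + n) ≡ oddᵇ m xor oddᵇ n
  oddᵇ-+ zero    n = refl
  oddᵇ-+ (suc m) n = trans (cong not (oddᵇ-+ m n)) (not-distribˡ-xor (oddᵇ m) (oddᵇ n))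

  2∣⇒oddᵇ≡false : ∀ {k} → 2 ∣ k → oddᵇ k ≡ false
  2∣⇒oddᵇ≡false (divides q refl) = oddᵇ-double q
    where
    oddᵇ-double : ∀ q → oddᵇ (q * 2) ≡ false
    oddᵇ-double zero    = refl
    oddᵇ-double (suc q) = trans (not-involutive _) (oddᵇ-double q)

  oddᵇ-countVec-zipWith : ∀ {k} (r s : Vec Bool k) →
                          oddᵇ (countVec (zipWith _xor_ r s)) ≡ oddᵇ (countVec r) xor oddᵇ (countVec s)
  oddᵇ-countVec-zipWith []ᵥ       []ᵥ       = refl
  oddᵇ-countVec-zipWith (a ∷ᵥ r) (b ∷ᵥ s) = begin
    oddᵇ (countVec ((a xor b) ∷ᵥ zipWith _xor_ r s))
      ≡⟨ oddᵇ-countVec-∷ (a xor b) _ ⟩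
    (a xor b) xor oddᵇ (countVec (zipWith _xor_ r s))
      ≡⟨ cong ((a xor b) xor_) (oddᵇ-countVec-zipWith r s) ⟩
    (a xor b) xor (oddᵇ (countVec r) xor oddᵇ (countVec s))
      ≡⟨ xor-interchange a b _ _ ⟩
    (a xor oddᵇ (countVec r)) xor (b xor oddᵇ (countVec s))
      ≡⟨ sym (cong₂ _xor_ (oddᵇ-countVec-∷ a r) (oddᵇ-countVec-∷ b s)) ⟩
    oddᵇ (countVec (a ∷ᵥ r)) xor oddᵇ (countVec (b ∷ᵥ s)) ∎
    where
    oddᵇ-countVec-∷ : ∀ {k} b (v : Vec Bool k) → oddᵇ (countVec (b ∷ᵥ v)) ≡ b xor oddᵇ (countVec v)
    oddᵇ-countVec-∷ true  v = refl
    oddᵇ-countVec-∷ false v = refl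

  oddEdges : ∀ {n} → Graph n → Bool
  oddEdges G = oddᵇ (edgeCount G)

  oddEdges-+G : ∀ {n} (G H : Graph n) → oddEdges (G +G H) ≡ oddEdges G xor oddEdges H
  oddEdges-+G {zero}  _       _       = refl
  oddEdges-+G {suc n} (g , r) (h , s) = begin
    oddᵇ (edgeCount (g +G h) + countVec (zipWith _xor_ r s))
      ≡⟨ oddᵇ-+ (edgeCount (g +G h)) _ ⟩
    oddEdges (g +G h) xor oddᵇ (countVec (zipWith _xor_ r s))
      ≡⟨ cong₂ _xor_ (oddEdges-+G g h) (oddᵇ-countVec-zipWith r s) ⟩
    (oddEdges g xor oddEdges h) xor (oddᵇ (countVec r) xor oddᵇ (countVec s))
      ≡⟨ xor-interchange (oddEdges g) _ _ _ ⟩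
    (oddEdges g xor oddᵇ (countVec r)) xor (oddEdges h xor oddᵇ (countVec s))
      ≡⟨ sym (cong₂ _xor_ (oddᵇ-+ (edgeCount g) (countVec r)) (oddᵇ-+ (edgeCount h) (countVec s))) ⟩
    oddEdges (g , r) xor oddEdges (h , s) ∎

  oddEdges-+G-odd : ∀ {n} (z : Graph n) {e} → oddEdges e ≡ true → oddEdges (z +G e) ≡ not (oddEdges z)
  oddEdges-+G-odd z {e} odd-e = trans (oddEdges-+G z e) (trans (cong (oddEdges z xor_) odd-e) (xor-comm _ true))

  singleEdge : ∀ m → Graph (suc (suc m))
  singleEdge m = emptyG , (true ∷ᵥ replicate m false)

  oddEdges-singleEdge : ∀ m → oddEdges (singleEdge m) ≡ true
  oddEdges-singleEdge m = cong₂ (λ a c → oddᵇ (a + suc c)) (edgeCount-emptyG (suc m)) (countVec-replicate m)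

  _·_ : ∀ {n} → Graph n → Graph n → Bool
  x · ξ = oddEdges (x ∩G ξ)

  ·-distribʳ-+G : ∀ {n} (x y ξ : Graph n) → (x +G y) · ξ ≡ (x · ξ) xor (y · ξ)
  ·-distribʳ-+G x y ξ = trans (cong oddEdges (∩G-distribʳ-+G x y ξ)) (oddEdges-+G (x ∩G ξ) (y ∩G ξ))

  countVec-∧-replicate : ∀ {k} (ρ : Vec Bool k) → countVec (zipWith _∧_ (replicate k false) ρ) ≡ 0
  countVec-∧-replicate []ᵥ      = refl
  countVec-∧-replicate (_ ∷ᵥ ρ) = countVec-∧-replicate ρ

  nondegenerateᵛ : ∀ {k} (ρ : Vec Bool k) →
                   ρ ≡ replicate k false ⊎ ∃[ v ] oddᵇ (countVec (zipWith _∧_ v ρ)) ≡ true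
  nondegenerateᵛ []ᵥ          = inj₁ refl
  nondegenerateᵛ (true ∷ᵥ ρ)  =
    inj₂ (true ∷ᵥ replicate _ false , cong (λ c → not (oddᵇ c)) (countVec-∧-replicate ρ))
  nondegenerateᵛ (false ∷ᵥ ρ) with nondegenerateᵛ ρ
  ... | inj₁ ρ≡0       = inj₁ (cong (false ∷ᵥ_) ρ≡0)
  ... | inj₂ (v , odd) = inj₂ (false ∷ᵥ v , odd)

  nondegenerate : ∀ {n} (ξ : Graph n) → ξ ≡ emptyG ⊎ ∃[ y ] y · ξ ≡ true
  nondegenerate {zero}  tt      = inj₁ refl
  nondegenerate {suc n} (ξ , ρ) with nondegenerateᵛ ρ
  ... | inj₂ (v , odd) = inj₂ ((emptyG , v) ,
    trans (oddᵇ-+ (edgeCount (emptyG ∩G ξ)) _) (cong₂ _xor_ emptyG·ξ≡0 odd))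
    where
    emptyG·ξ≡0 : emptyG · ξ ≡ false
    emptyG·ξ≡0 = trans (cong oddEdges (∩G-zeroˡ ξ)) (cong oddᵇ (edgeCount-emptyG n))
  ... | inj₁ ρ≡0 with nondegenerate ξ
  ...   | inj₁ ξ≡0       = inj₁ (cong₂ _,_ ξ≡0 ρ≡0)
  ...   | inj₂ (y , odd) = inj₂ ((y , replicate n false) ,
    trans (oddᵇ-+ (edgeCount (y ∩G ξ)) _) (cong₂ _xor_ odd (cong oddᵇ (countVec-∧-replicate ρ))))

open Parity

module EdgeCountInvariance where

  open import Data.Bool.Properties using (if-eta)
  open import Data.Nat using (_+_; _*_)
  open import Data.Nat.Properties using (+-0-commutativeMonoid; +-identityʳ; *-cancelˡ-≡) renaming (_≟_ to _≟ℕ_)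
  open import Data.Nat.Solver using (module +-*-Solver)
  open import Data.Fin.Properties using (_≟_)
  open import Data.Vec using (Vec; lookup) renaming ([] to []ᵥ; _∷_ to _∷ᵥ_)
  open import Algebra.Properties.CommutativeMonoid.Sum +-0-commutativeMonoid
    using (sum; sum-syntax; ∑-distrib-+; ∑-comm; sum-cong-≗; sum-replicate-zero)
  open import Relation.Nullary.Decidable using (dec-true)
  open ≡-Reasoning

  𝟙 : Bool → ℕ
  𝟙 true  = 1
  𝟙 false = 0

  𝟙≢0⇒≡true : ∀ {b} → 𝟙 b ≢ 0 → b ≡ true
  𝟙≢0⇒≡true {true}  _   = refl
  𝟙≢0⇒≡true {false} 0≢0 = contradiction refl 0≢0

  ∑-nonzero : ∀ {n} (f : Fin n → ℕ) → ∑[ i < n ] f i ≢ 0 → ∃[ i ] f i ≢ 0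
  ∑-nonzero {zero}  f ∑≢0 = contradiction refl ∑≢0
  ∑-nonzero {suc n} f ∑≢0 with f zero ≟ℕ 0
  ... | no  f₀≢0 = zero , f₀≢0
  ... | yes f₀≡0 with ∑-nonzero (λ i → f (suc i)) (λ ∑≡0 → ∑≢0 (cong₂ _+_ f₀≡0 ∑≡0))
  ...   | i , fᵢ≢0 = suc i , fᵢ≢0

  ∑-point : ∀ {n} (c : Fin n) (a : ℕ) → ∑[ j < n ] (if does (j ≟ c) then a else 0) ≡ a
  ∑-point {suc n} zero    a = trans (cong (a +_) (sum-replicate-zero n)) (+-identityʳ a)
  ∑-point {suc n} (suc c) a = ∑-point c a

  linked : ∀ {n k} → (Fin n → Fin k) → (Fin k → Fin n) → Fin n → Fin k → Bool
  linked φ ψ i j = does (j ≟ φ i) ∧ does (i ≟ ψ j)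

  ∑-linked : ∀ {n k} (φ : Fin n → Fin k) (ψ : Fin k → Fin n) (f : Fin n → ℕ) →
             (∀ i → f i ≢ 0 → ψ (φ i) ≡ i) → ∀ i → ∑[ j < k ] (if linked φ ψ i j then f i else 0) ≡ f i
  ∑-linked {k = k} φ ψ f ψφ i with f i ≟ℕ 0
  ... | yes fᵢ≡0 = begin
    ∑[ j < k ] (if linked φ ψ i j then f i else 0)
      ≡⟨ sum-cong-≗ (λ j → trans (cong (λ a → if linked φ ψ i j then a else 0) fᵢ≡0) (if-eta _)) ⟩
    ∑[ j < k ] 0  ≡⟨ sum-replicate-zero k ⟩
    0             ≡⟨ sym fᵢ≡0 ⟩
    f i           ∎
  ... | no fᵢ≢0 = trans (sum-cong-≗ (λ j → cong (λ b → if b then f i else 0) (linked≡ j))) (∑-point (φ i) (f i))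
    where
    linked≡ : ∀ j → linked φ ψ i j ≡ does (j ≟ φ i)
    linked≡ j with j ≟ φ i
    ... | no  _    = refl
    ... | yes refl = dec-true (i ≟ ψ (φ i)) (sym (ψφ i fᵢ≢0))

  -- Double counting over the pairs (i , j) with j = φ i and i = ψ j.
  ∑-transfer : ∀ {n k} (φ : Fin n → Fin k) (ψ : Fin k → Fin n) (f : Fin n → ℕ) (g : Fin k → ℕ) →
               (∀ i → f i ≢ 0 → ψ (φ i) ≡ i × g (φ i) ≡ f i) →
               (∀ j → g j ≢ 0 → φ (ψ j) ≡ j × f (ψ j) ≡ g j) →
               ∑[ i < n ] f i ≡ ∑[ j < k ] g j
  ∑-transfer {n} {k} φ ψ f g f→g g→f = begin
    ∑[ i < n ] f i
      ≡⟨ sum-cong-≗ (λ i → sym (∑-linked φ ψ f (λ i fᵢ≢0 → proj₁ (f→g i fᵢ≢0)) i)) ⟩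
    ∑[ i < n ] ∑[ j < k ] (if linked φ ψ i j then f i else 0)
      ≡⟨ ∑-comm (λ i j → if linked φ ψ i j then f i else 0) ⟩
    ∑[ j < k ] ∑[ i < n ] (if linked φ ψ i j then f i else 0)
      ≡⟨ sum-cong-≗ (λ j → sum-cong-≗ (λ i → linked-term i j)) ⟩
    ∑[ j < k ] ∑[ i < n ] (if linked ψ φ j i then g j else 0)
      ≡⟨ sum-cong-≗ (∑-linked ψ φ g (λ j gⱼ≢0 → proj₁ (g→f j gⱼ≢0))) ⟩
    ∑[ j < k ] g j
      ∎
    where
    linked-value : ∀ i j → j ≡ φ i → i ≡ ψ j → f i ≡ g j
    linked-value i _ refl i≡ψφi with f i ≟ℕ 0 | g (φ i) ≟ℕ 0
    ... | no  fᵢ≢0 | _        = sym (proj₂ (f→g i fᵢ≢0))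
    ... | yes fᵢ≡0 | yes gⱼ≡0 = trans fᵢ≡0 (sym gⱼ≡0)
    ... | yes _    | no  gⱼ≢0 = trans (cong f i≡ψφi) (proj₂ (g→f (φ i) gⱼ≢0))
    linked-term : ∀ i j → (if linked φ ψ i j then f i else 0) ≡ (if linked ψ φ j i then g j else 0)
    linked-term i j with j ≟ φ i | i ≟ ψ j
    ... | yes p | yes q = linked-value i j p q
    ... | yes _ | no  _ = refl
    ... | no  _ | yes _ = refl
    ... | no  _ | no  _ = refl

  ∑-countVec : ∀ {k} (r : Vec Bool k) → ∑[ j < k ] 𝟙 (lookup r j) ≡ countVec r
  ∑-countVec []ᵥ          = refl
  ∑-countVec (true ∷ᵥ r)  = cong suc (∑-countVec r)
  ∑-countVec (false ∷ᵥ r) = ∑-countVec r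

  deg : ∀ {n} → Graph n → Fin n → ℕ
  deg {n} G i = ∑[ j < n ] 𝟙 (adj G i j)

  handshake : ∀ {n} (G : Graph n) → ∑[ i < n ] deg G i ≡ 2 * edgeCount G
  handshake {zero}  _       = refl
  handshake {suc n} (g , r) = begin
    ∑[ j < n ] 𝟙 (lookup r j) + ∑[ i < n ] (𝟙 (lookup r i) + deg g i)
      ≡⟨ cong (_ +_) (∑-distrib-+ (λ i → 𝟙 (lookup r i)) (deg g)) ⟩
    ∑[ j < n ] 𝟙 (lookup r j) + (∑[ i < n ] 𝟙 (lookup r i) + ∑[ i < n ] deg g i)
      ≡⟨ cong₂ (λ c d → c + (c + d)) (∑-countVec r) (handshake g) ⟩
    countVec r + (countVec r + 2 * edgeCount g)
      ≡⟨ solve 2 (λ c e → c :+ (c :+ con 2 :* e) := con 2 :* (e :+ c)) refl (countVec r) (edgeCount g) ⟩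
    2 * (edgeCount g + countVec r)
      ∎
    where open +-*-Solver

  adj⇒InV : ∀ {n} (G : Graph n) i j → adj G i j ≡ true → InV G j
  adj⇒InV G i j e = i , trans (adj-sym G j i) e

  deg≢0⇒InV : ∀ {n} (G : Graph n) i → deg G i ≢ 0 → InV G i
  deg≢0⇒InV G i deg≢0 with ∑-nonzero (λ j → 𝟙 (adj G i j)) deg≢0
  ... | j , e≢0 = j , 𝟙≢0⇒≡true e≢0

  Iso⇒edgeCount≡ : ∀ {n k} {G : Graph n} {H : Graph k} → Iso G H → edgeCount G ≡ edgeCount H
  Iso⇒edgeCount≡ {G = G} {H} (φ , ψ , G→H , H→G , adj≡) = *-cancelˡ-≡ _ _ 2 (begin
    2 * edgeCount G  ≡⟨ sym (handshake G) ⟩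
    sum (deg G)      ≡⟨ ∑-transfer φ ψ (deg G) (deg H) deg-G→H deg-H→G ⟩
    sum (deg H)      ≡⟨ handshake H ⟩
    2 * edgeCount H  ∎)
    where
    deg-φ : ∀ i → InV G i → deg H (φ i) ≡ deg G i
    deg-φ i vᵢ = sym (∑-transfer φ ψ (λ j → 𝟙 (adj G i j)) (λ w → 𝟙 (adj H (φ i) w)) row-G→H row-H→G)
      where
      row-G→H : ∀ j → 𝟙 (adj G i j) ≢ 0 → ψ (φ j) ≡ j × 𝟙 (adj H (φ i) (φ j)) ≡ 𝟙 (adj G i j)
      row-G→H j e≢0 = let vⱼ = adj⇒InV G i j (𝟙≢0⇒≡true e≢0) in
        proj₂ (G→H j vⱼ) , cong 𝟙 (sym (adj≡ i j vᵢ vⱼ))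
      row-H→G : ∀ w → 𝟙 (adj H (φ i) w) ≢ 0 → φ (ψ w) ≡ w × 𝟙 (adj G i (ψ w)) ≡ 𝟙 (adj H (φ i) w)
      row-H→G w e≢0 = let (v , φψw≡w) = H→G w (adj⇒InV H (φ i) w (𝟙≢0⇒≡true e≢0)) in
        φψw≡w , cong 𝟙 (trans (adj≡ i (ψ w) vᵢ v) (cong (adj H (φ i)) φψw≡w))
    deg-G→H : ∀ i → deg G i ≢ 0 → ψ (φ i) ≡ i × deg H (φ i) ≡ deg G i
    deg-G→H i d≢0 = let vᵢ = deg≢0⇒InV G i d≢0 in proj₂ (G→H i vᵢ) , deg-φ i vᵢ
    deg-H→G : ∀ j → deg H j ≢ 0 → φ (ψ j) ≡ j × deg G (ψ j) ≡ deg H j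
    deg-H→G j d≢0 = let (v , φψj≡j) = H→G j (deg≢0⇒InV H j d≢0) in
      φψj≡j , trans (sym (deg-φ (ψ j) v)) (cong (deg H) φψj≡j)

  idIso : ∀ {n} (G : Graph n) → Iso G G
  idIso G = (λ i → i) , (λ i → i) , (λ _ v → v , refl) , (λ _ v → v , refl) , (λ _ _ _ _ → refl)

open EdgeCountInvariance

module Ramsey where

  import Data.Bool.Properties as Bool
  open import Data.Nat using (_+_; _*_; _^_; _≤_)
  open import Data.Nat.Properties
    using (+-suc; +-identityʳ; ≤-trans; +-cancelˡ-≤; +-monoˡ-≤; ≰⇒>; m^n>0; ^-*-assoc; _≤?_; module ≤-Reasoning)
  open import Data.Fin.Properties using (_≟_)
  open import Data.List using (List; []; _∷_; length; filter; allFin)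
  open import Data.List.Properties using (length-tabulate)
  open import Data.List.Membership.Propositional using (_∈_)
  open import Data.List.Membership.Propositional.Properties using (∈-filter⁻)
  open import Data.List.Relation.Unary.Any using (here; there)
  open import Data.List.Relation.Unary.All as All using (All)
  open import Data.List.Relation.Unary.AllPairs using (_∷_)
  open import Data.List.Relation.Unary.Unique.Propositional using (Unique)
  open import Data.List.Relation.Unary.Unique.Propositional.Properties using (filter⁺; allFin⁺)
  import Data.Vec.Functional as Vector

  module _ {A : Set} (c : A → A → Bool) (c-sym : ∀ u v → c u v ≡ c v u) where

    Monochromatic : Bool → List A → ℕ → Set
    Monochromatic col L k =
      Σ (Fin k → A) λ ι → (∀ p → ι p ∈ L) × (∀ p q → p ≢ q → ι p ≢ ι q × c (ι p) (ι q) ≡ col)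

    neighbours : Bool → A → List A → List A
    neighbours col v = filter (λ u → c v u Bool.≟ col)

    length-neighbours : ∀ v L → length (neighbours true v L) + length (neighbours false v L) ≡ length L
    length-neighbours v []      = refl
    length-neighbours v (u ∷ L) with c v u
    ... | true  = cong suc (length-neighbours v L)
    ... | false = trans (+-suc _ _) (cong suc (length-neighbours v L))

    extend : ∀ {col k} v L → All (v ≢_) L → Monochromatic col (neighbours col v L) k →
             Monochromatic col (v ∷ L) (suc k)
    extend {col} {k} v L v∉L (ι , ι∈ , mono) = ι′ , ι′∈ , ι′-mono
      where
      ι′ : Fin (suc k) → A
      ι′ = v Vector.∷ ι
      member : ∀ p → ι p ∈ L × c v (ι p) ≡ col
      member p = ∈-filter⁻ (λ u → c v u Bool.≟ col) (ι∈ p)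
      v≢ι : ∀ p → v ≢ ι p
      v≢ι p = All.lookup v∉L (proj₁ (member p))
      ι′∈ : ∀ p → ι′ p ∈ v ∷ L
      ι′∈ zero    = here refl
      ι′∈ (suc p) = there (proj₁ (member p))
      ι′-mono : ∀ p q → p ≢ q → ι′ p ≢ ι′ q × c (ι′ p) (ι′ q) ≡ col
      ι′-mono zero    zero    p≢q = contradiction refl p≢q
      ι′-mono zero    (suc q) _   = v≢ι q , proj₂ (member q)
      ι′-mono (suc p) zero    _   = (λ e → v≢ι p (sym e)) , trans (c-sym _ _) (proj₂ (member p))
      ι′-mono (suc p) (suc q) p≢q = mono p q (λ e → p≢q (cong suc e))

    weaken : ∀ {col col′ k} v L → Monochromatic col (neighbours col′ v L) k → Monochromatic col (v ∷ L) k
    weaken {col′ = col′} v L (ι , ι∈ , mono) =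
      ι , (λ p → there (proj₁ (∈-filter⁻ (λ u → c v u Bool.≟ col′) (ι∈ p)))) , mono

    ramsey : ∀ a b L → Unique L → 2 ^ (a + b) ≤ length L → Monochromatic true L a ⊎ Monochromatic false L b
    ramsey zero    b       L       _ _   = inj₁ ((λ ()) , (λ ()) , (λ ()))
    ramsey (suc a) zero    L       _ _   = inj₂ ((λ ()) , (λ ()) , (λ ()))
    ramsey (suc a) (suc b) []      _ big = contradiction (≤-trans (m^n>0 2 (suc a + suc b)) big) λ ()
    ramsey (suc a) (suc b) (v ∷ L) (v∉L ∷ unique) big with 2 ^ (a + suc b) ≤? length (neighbours true v L)
    ... | yes red-big with ramsey a (suc b) (neighbours true v L) (filter⁺ _ unique) red-big
    ...   | inj₁ red  = inj₁ (extend v L v∉L red)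
    ...   | inj₂ blue = inj₂ (weaken v L blue)
    ramsey (suc a) (suc b) (v ∷ L) (v∉L ∷ unique) big | no red-small
      with ramsey (suc a) b (neighbours false v L) (filter⁺ _ unique) (blue-big red-small)
      where
      blue-big : ¬ 2 ^ (a + suc b) ≤ length (neighbours true v L) → 2 ^ (suc a + b) ≤ length (neighbours false v L)
      blue-big ¬red = +-cancelˡ-≤ X X B (begin
        X + X                ≡⟨ cong (X +_) (sym (+-identityʳ X)) ⟩
        2 * X                ≡⟨ cong (2 *_) (sym 2^[a+1+b]≡X) ⟩
        2 ^ (suc a + suc b)  ≤⟨ big ⟩
        suc (length L)       ≡⟨ cong suc (sym (length-neighbours v L)) ⟩
        suc R + B            ≤⟨ +-monoˡ-≤ B (subst (suc R ≤_) 2^[a+1+b]≡X (≰⇒> ¬red)) ⟩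
        X + B                ∎)
        where
        open ≤-Reasoning
        R = length (neighbours true v L)
        B = length (neighbours false v L)
        X = 2 ^ (suc a + b)
        2^[a+1+b]≡X : 2 ^ (a + suc b) ≡ X
        2^[a+1+b]≡X = cong (2 ^_) (+-suc a b)
    ... | inj₁ red  = inj₁ (weaken v L red)
    ... | inj₂ blue = inj₂ (extend v L v∉L blue)

  record HomogeneousSet {n} (ξ : Graph n) (m : ℕ) : Set where
    field
      colour      : Bool
      ι           : Fin m → Fin n
      ι-injective : ∀ {a b} → ι a ≡ ι b → a ≡ b
      homogeneous : ∀ {a b} → a ≢ b → adj ξ (ι a) (ι b) ≡ colour

  fromMonochromatic : ∀ {n m col} (ξ : Graph n) →
                      Monochromatic (adj ξ) (adj-sym ξ) col (allFin n) m → HomogeneousSet ξ m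
  fromMonochromatic {col = col} ξ (ι , _ , mono) = record
    { colour      = col
    ; ι           = ι
    ; ι-injective = injective
    ; homogeneous = λ {a} {b} a≢b → proj₂ (mono a b a≢b)
    }
    where
    injective : ∀ {a b} → ι a ≡ ι b → a ≡ b
    injective {a} {b} ιa≡ιb with a ≟ b
    ... | yes a≡b = a≡b
    ... | no  a≢b = contradiction ιa≡ιb (proj₁ (mono a b a≢b))

  homogeneousSet : ∀ {n} m (ξ : Graph n) → 4 ^ m ≤ n → HomogeneousSet ξ m
  homogeneousSet {n} m ξ 4^m≤n =
    [ fromMonochromatic ξ , fromMonochromatic ξ ]′ (ramsey (adj ξ) (adj-sym ξ) m m (allFin n) (allFin⁺ n) 2^[m+m]≤n)
    where
    2^[m+m]≤n : 2 ^ (m + m) ≤ length (allFin n)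
    2^[m+m]≤n = subst₂ _≤_ (trans (^-*-assoc 2 2 m) (cong (λ k → 2 ^ (m + k)) (+-identityʳ m)))
                           (sym (length-tabulate (λ i → i))) 4^m≤n

open Ramsey using (HomogeneousSet; homogeneousSet)

-- a₀ is only the junk value of ι⁻¹ off the image of ι.
module Embedding {m n} (ι : Fin m → Fin n) (ι-injective : ∀ {a b} → ι a ≡ ι b → a ≡ b) (a₀ : Fin m) where

  open import Data.Bool.Properties using (∧-zeroʳ; ∧-identityʳ)
  open import Data.Fin.Properties using (_≟_; any?)
  open import Function using (_∘_)
  open ≡-Reasoning

  ι⁻¹ : Fin n → Fin m
  ι⁻¹ i with any? (λ a → ι a ≟ i)
  ... | yes (a , _) = a
  ... | no  _       = a₀

  ι⁻¹-ι : ∀ a → ι⁻¹ (ι a) ≡ a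
  ι⁻¹-ι a with any? (λ b → ι b ≟ ι a)
  ... | yes (b , ιb≡ιa) = ι-injective ιb≡ιa
  ... | no  ∄           = contradiction (a , refl) ∄

  pushAdj : Graph m → Fin n → Fin n → Bool
  pushAdj z i j with any? (λ a → ι a ≟ i) | any? (λ b → ι b ≟ j)
  ... | yes (a , _) | yes (b , _) = adj z a b
  ... | _           | _           = false

  pushAdj-sym : ∀ z i j → pushAdj z i j ≡ pushAdj z j i
  pushAdj-sym z i j with any? (λ a → ι a ≟ i) | any? (λ b → ι b ≟ j)
  ... | yes (a , _) | yes (b , _) = adj-sym z a b
  ... | yes _       | no  _       = refl
  ... | no  _       | yes _       = refl
  ... | no  _       | no  _       = refl

  pushAdj-irrefl : ∀ z i → pushAdj z i i ≡ false
  pushAdj-irrefl z i with any? (λ a → ι a ≟ i)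
  ... | yes (a , _) = adj-irrefl z a
  ... | no  _       = refl

  emb : Graph m → Graph n
  emb z = fromAdj (pushAdj z)

  adj-emb : ∀ z i j → adj (emb z) i j ≡ pushAdj z i j
  adj-emb z = adj-fromAdj (pushAdj z) (pushAdj-sym z) (pushAdj-irrefl z)

  adj-emb-ι : ∀ z a b → adj (emb z) (ι a) (ι b) ≡ adj z a b
  adj-emb-ι z a b = trans (adj-emb z (ι a) (ι b)) pushAdj-ι
    where
    pushAdj-ι : pushAdj z (ι a) (ι b) ≡ adj z a b
    pushAdj-ι with any? (λ a′ → ι a′ ≟ ι a) | any? (λ b′ → ι b′ ≟ ι b)
    ... | yes (_ , e) | yes (_ , e′) = cong₂ (adj z) (ι-injective e) (ι-injective e′)
    ... | yes _       | no  ∄        = contradiction (b , refl) ∄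
    ... | no  ∄       | _            = contradiction (a , refl) ∄

  adj-emb⇒image : ∀ z i j → adj (emb z) i j ≡ true → ∃₂ λ a b → ι a ≡ i × ι b ≡ j
  adj-emb⇒image z i j e = pushAdj⇒image (trans (sym (adj-emb z i j)) e)
    where
    pushAdj⇒image : pushAdj z i j ≡ true → ∃₂ λ a b → ι a ≡ i × ι b ≡ j
    pushAdj⇒image with any? (λ a → ι a ≟ i) | any? (λ b → ι b ≟ j)
    ... | yes (a , ιa≡i) | yes (b , ιb≡j) = λ _ → a , b , ιa≡i , ιb≡j
    ... | yes _          | no  _          = λ ()
    ... | no  _          | _              = λ ()

  emb-+G : ∀ z z′ → emb (z +G z′) ≡ emb z +G emb z′
  emb-+G z z′ = adj-ext _ _ λ i j → begin
    adj (emb (z +G z′)) i j               ≡⟨ adj-emb (z +G z′) i j ⟩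
    pushAdj (z +G z′) i j                 ≡⟨ pushAdj-+G i j ⟩
    pushAdj z i j xor pushAdj z′ i j      ≡⟨ sym (cong₂ _xor_ (adj-emb z i j) (adj-emb z′ i j)) ⟩
    adj (emb z) i j xor adj (emb z′) i j  ≡⟨ sym (adj-+G (emb z) (emb z′) i j) ⟩
    adj (emb z +G emb z′) i j             ∎
    where
    pushAdj-+G : ∀ i j → pushAdj (z +G z′) i j ≡ pushAdj z i j xor pushAdj z′ i j
    pushAdj-+G i j with any? (λ a → ι a ≟ i) | any? (λ b → ι b ≟ j)
    ... | yes (a , _) | yes (b , _) = adj-+G z z′ a b
    ... | yes _       | no  _       = refl
    ... | no  _       | _           = refl

  InV-emb : ∀ {z v} → InV (emb z) v → ∃[ a ] ι a ≡ v × InV z a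
  InV-emb {z} {v} (u , e) with adj-emb⇒image z v u e
  ... | a , b , refl , refl = a , refl , b , trans (sym (adj-emb-ι z a b)) e

  emb-Iso : ∀ {k} {z : Graph m} {H : Graph k} → Iso z H → Iso (emb z) H
  emb-Iso {z = z} {H} (φ , ψ , z→H , H→z , adj≡) = φ ∘ ι⁻¹ , ι ∘ ψ , emb→H , H→emb , adj-emb≡
    where
    emb→H : ∀ v → InV (emb z) v → InV H (φ (ι⁻¹ v)) × ι (ψ (φ (ι⁻¹ v))) ≡ v
    emb→H v vᵥ with InV-emb vᵥ
    ... | a , refl , vₐ rewrite ι⁻¹-ι a = proj₁ (z→H a vₐ) , cong ι (proj₂ (z→H a vₐ))
    H→emb : ∀ w → InV H w → InV (emb z) (ι (ψ w)) × φ (ι⁻¹ (ι (ψ w))) ≡ w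
    H→emb w v𝓌 with H→z w v𝓌
    ... | (u , e) , φψw≡w rewrite ι⁻¹-ι (ψ w) = (ι u , trans (adj-emb-ι z (ψ w) u) e) , φψw≡w
    adj-emb≡ : ∀ x y → InV (emb z) x → InV (emb z) y → adj (emb z) x y ≡ adj H (φ (ι⁻¹ x)) (φ (ι⁻¹ y))
    adj-emb≡ x y vₓ vᵧ with InV-emb vₓ | InV-emb vᵧ
    ... | a , refl , vₐ | b , refl , v_b rewrite ι⁻¹-ι a | ι⁻¹-ι b = trans (adj-emb-ι z a b) (adj≡ a b vₐ v_b)

  edgeCount-emb : ∀ z → edgeCount (emb z) ≡ edgeCount z
  edgeCount-emb z = Iso⇒edgeCount≡ (emb-Iso (idIso z))

  emb-∩G-homogeneous : ∀ {ξ col} → (∀ {a b} → a ≢ b → adj ξ (ι a) (ι b) ≡ col) →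
                       ∀ z → emb z ∩G ξ ≡ (if col then emb z else emptyG)
  emb-∩G-homogeneous {ξ} {col} hom z = adj-ext _ _ λ i j →
    trans (adj-∩G (emb z) ξ i j) (trans (pointwise i j) (sym (adj-if col i j)))
    where
    adj-if : ∀ col i j → adj (if col then emb z else emptyG) i j ≡ col ∧ adj (emb z) i j
    adj-if true  i j = refl
    adj-if false i j = adj-emptyG i j
    pointwise : ∀ i j → adj (emb z) i j ∧ adj ξ i j ≡ col ∧ adj (emb z) i j
    pointwise i j with adj (emb z) i j in e
    ... | false = sym (∧-zeroʳ col)
    ... | true with adj-emb⇒image z i j e
    ...   | a , b , refl , refl = trans (hom a≢b) (sym (∧-identityʳ col))
      where
      a≢b : a ≢ b
      a≢b refl = contradiction (trans (sym e) (adj-irrefl (emb z) (ι a))) λ ()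

  ·-emb : ∀ {ξ col} → (∀ {a b} → a ≢ b → adj ξ (ι a) (ι b) ≡ col) → ∀ z → emb z · ξ ≡ col ∧ oddEdges z
  ·-emb {ξ} {col} hom z = trans (cong oddEdges (emb-∩G-homogeneous hom z)) (by-colour col)
    where
    by-colour : ∀ col → oddEdges (if col then emb z else emptyG) ≡ col ∧ oddEdges z
    by-colour true  = cong oddᵇ (edgeCount-emb z)
    by-colour false = cong oddᵇ (edgeCount-emptyG n)

module Counting where

  open import Data.Bool.Properties using (xor-same)
  open import Data.Nat using (_+_; _*_; _^_; _≤_; z≤n)
  open import Data.Nat.Properties
    using (+-assoc; +-comm; +-identityʳ; *-comm; *-identityʳ; *-zeroʳ; *-distribˡ-+; +-mono-≤;
           ^-distribˡ-+-*; +-commutativeSemigroup)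
  open import Data.Nat.Combinatorics using (_C_; nCk+nC[k+1]≡[n+1]C[k+1]; nC1≡n)
  open import Data.List using (List; []; _∷_; _++_; map; concatMap; length)
  open import Data.Vec using (Vec; zipWith) renaming ([] to []ᵥ; _∷_ to _∷ᵥ_)
  open import Algebra.Properties.CommutativeSemigroup +-commutativeSemigroup using (interchange)
  open ≡-Reasoning

  private
    variable
      A B : Set

  sumOver : List A → (A → ℕ) → ℕ
  sumOver []       f = 0
  sumOver (x ∷ xs) f = f x + sumOver xs f

  sumOver-++ : ∀ (xs ys : List A) f → sumOver (xs ++ ys) f ≡ sumOver xs f + sumOver ys f
  sumOver-++ []       ys f = refl
  sumOver-++ (x ∷ xs) ys f = trans (cong (f x +_) (sumOver-++ xs ys f)) (sym (+-assoc (f x) _ _))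

  sumOver-concatMap : ∀ (h : A → List B) xs f → sumOver (concatMap h xs) f ≡ sumOver xs (λ x → sumOver (h x) f)
  sumOver-concatMap h []       f = refl
  sumOver-concatMap h (x ∷ xs) f = trans (sumOver-++ (h x) _ f) (cong (_ +_) (sumOver-concatMap h xs f))

  sumOver-map : ∀ (h : A → B) xs f → sumOver (map h xs) f ≡ sumOver xs (λ x → f (h x))
  sumOver-map h []       f = refl
  sumOver-map h (x ∷ xs) f = cong (_ +_) (sumOver-map h xs f)

  sumOver-cong : ∀ xs {f g : A → ℕ} → (∀ x → f x ≡ g x) → sumOver xs f ≡ sumOver xs g
  sumOver-cong []       f≗g = refl
  sumOver-cong (x ∷ xs) f≗g = cong₂ _+_ (f≗g x) (sumOver-cong xs f≗g)

  sumOver-mono : ∀ xs {f g : A → ℕ} → (∀ x → f x ≤ g x) → sumOver xs f ≤ sumOver xs g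
  sumOver-mono []       f≤g = z≤n
  sumOver-mono (x ∷ xs) f≤g = +-mono-≤ (f≤g x) (sumOver-mono xs f≤g)

  sumOver-+ : ∀ xs (f g : A → ℕ) → sumOver xs (λ x → f x + g x) ≡ sumOver xs f + sumOver xs g
  sumOver-+ []       f g = refl
  sumOver-+ (x ∷ xs) f g = trans (cong (f x + g x +_) (sumOver-+ xs f g)) (interchange (f x) (g x) _ _)

  sumOver-*ˡ : ∀ xs c (f : A → ℕ) → sumOver xs (λ x → c * f x) ≡ c * sumOver xs f
  sumOver-*ˡ []       c f = sym (*-zeroʳ c)
  sumOver-*ˡ (x ∷ xs) c f = trans (cong (c * f x +_) (sumOver-*ˡ xs c f)) (sym (*-distribˡ-+ c (f x) _))

  sumOver-const : ∀ (xs : List A) c → sumOver xs (λ _ → c) ≡ length xs * c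
  sumOver-const []       c = refl
  sumOver-const (x ∷ xs) c = cong (c +_) (sumOver-const xs c)

  sumOver-one : ∀ (xs : List A) → sumOver xs (λ _ → 1) ≡ length xs
  sumOver-one xs = trans (sumOver-const xs 1) (*-identityʳ _)

  sumOver-comm : ∀ (xs : List A) (ys : List B) (f : A → B → ℕ) →
                 sumOver xs (λ x → sumOver ys (f x)) ≡ sumOver ys (λ y → sumOver xs (λ x → f x y))
  sumOver-comm []       ys f = sym (trans (sumOver-const ys 0) (*-zeroʳ (length ys)))
  sumOver-comm (x ∷ xs) ys f =
    trans (cong (sumOver ys (f x) +_) (sumOver-comm xs ys f)) (sym (sumOver-+ ys (f x) _))

  ∑G : ∀ {n} → (Graph n → ℕ) → ℕ
  ∑G {n} = sumOver (allGraphs n)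

  ∑G-split : ∀ n (f : Graph (suc n) → ℕ) → ∑G f ≡ ∑G (λ g → sumOver (allVecs n) (λ r → f (g , r)))
  ∑G-split n f =
    trans (sumOver-concatMap _ (allGraphs n) f) (sumOver-cong (allGraphs n) (λ g → sumOver-map (g ,_) (allVecs n) f))

  sumOver-allVecs-translate : ∀ k (b : Vec Bool k) f →
                              sumOver (allVecs k) (λ v → f (zipWith _xor_ v b)) ≡ sumOver (allVecs k) f
  sumOver-allVecs-translate zero    []ᵥ       f = refl
  sumOver-allVecs-translate (suc k) (b₀ ∷ᵥ b) f = begin
    sumOver (allVecs (suc k)) (λ v → f (zipWith _xor_ v (b₀ ∷ᵥ b)))
      ≡⟨ sumOver-concatMap pair (allVecs k) _ ⟩
    sumOver (allVecs k) (λ v → pairSum (λ c → f ((c xor b₀) ∷ᵥ zipWith _xor_ v b)))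
      ≡⟨ sumOver-cong (allVecs k) (λ v → pairSum-xor b₀ (zipWith _xor_ v b)) ⟩
    sumOver (allVecs k) (λ v → pairSum (λ c → f (c ∷ᵥ zipWith _xor_ v b)))
      ≡⟨ sumOver-allVecs-translate k b (λ w → pairSum (λ c → f (c ∷ᵥ w))) ⟩
    sumOver (allVecs k) (λ w → pairSum (λ c → f (c ∷ᵥ w)))
      ≡⟨ sym (sumOver-concatMap pair (allVecs k) f) ⟩
    sumOver (allVecs (suc k)) f
      ∎
    where
    pair : Vec Bool k → List (Vec Bool (suc k))
    pair v = (true ∷ᵥ v) ∷ (false ∷ᵥ v) ∷ []
    pairSum : (Bool → ℕ) → ℕ
    pairSum h = h true + (h false + 0)
    pairSum-xor : ∀ b₀ w → pairSum (λ c → f ((c xor b₀) ∷ᵥ w)) ≡ pairSum (λ c → f (c ∷ᵥ w))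
    pairSum-xor false w = refl
    pairSum-xor true  w = trans (cong (f (false ∷ᵥ w) +_) (+-identityʳ _))
                         (trans (+-comm (f (false ∷ᵥ w)) _) (cong (f (true ∷ᵥ w) +_) (sym (+-identityʳ _))))

  ∑G-translate : ∀ {n} (a : Graph n) (f : Graph n → ℕ) → ∑G (λ x → f (x +G a)) ≡ ∑G f
  ∑G-translate {zero}  tt      f = refl
  ∑G-translate {suc n} (a , b) f = begin
    ∑G (λ x → f (x +G (a , b)))
      ≡⟨ ∑G-split n _ ⟩
    ∑G (λ g → sumOver (allVecs n) (λ r → f (g +G a , zipWith _xor_ r b)))
      ≡⟨ sumOver-cong (allGraphs n) (λ g → sumOver-allVecs-translate n b (λ r → f (g +G a , r))) ⟩
    ∑G (λ g → sumOver (allVecs n) (λ r → f (g +G a , r)))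
      ≡⟨ ∑G-translate a (λ g → sumOver (allVecs n) (λ r → f (g , r))) ⟩
    ∑G (λ g → sumOver (allVecs n) (λ r → f (g , r)))
      ≡⟨ sym (∑G-split n f) ⟩
    ∑G f
      ∎

  length-allVecs : ∀ k → length (allVecs k) ≡ 2 ^ k
  length-allVecs zero    = refl
  length-allVecs (suc k) = begin
    length (allVecs (suc k))             ≡⟨ sym (sumOver-one (allVecs (suc k))) ⟩
    sumOver (allVecs (suc k)) (λ _ → 1)  ≡⟨ sumOver-concatMap _ (allVecs k) _ ⟩
    sumOver (allVecs k) (λ _ → 2)        ≡⟨ sumOver-const (allVecs k) 2 ⟩
    length (allVecs k) * 2               ≡⟨ cong (_* 2) (length-allVecs k) ⟩
    2 ^ k * 2                            ≡⟨ *-comm (2 ^ k) 2 ⟩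
    2 ^ suc k                            ∎

  length-allGraphs : ∀ n → length (allGraphs n) ≡ 2 ^ (n C 2)
  length-allGraphs zero    = refl
  length-allGraphs (suc n) = begin
    length (allGraphs (suc n))
      ≡⟨ sym (sumOver-one (allGraphs (suc n))) ⟩
    ∑G {suc n} (λ _ → 1)
      ≡⟨ ∑G-split n _ ⟩
    ∑G {n} (λ _ → sumOver (allVecs n) (λ _ → 1))
      ≡⟨ sumOver-cong (allGraphs n) (λ _ → trans (sumOver-one (allVecs n)) (length-allVecs n)) ⟩
    ∑G {n} (λ _ → 2 ^ n)
      ≡⟨ sumOver-const (allGraphs n) (2 ^ n) ⟩
    length (allGraphs n) * 2 ^ n
      ≡⟨ cong (_* 2 ^ n) (length-allGraphs n) ⟩
    2 ^ (n C 2) * 2 ^ n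
      ≡⟨ sym (^-distribˡ-+-* 2 (n C 2) n) ⟩
    2 ^ (n C 2 + n)
      ≡⟨ cong (2 ^_) (trans (+-comm (n C 2) n) (cong (_+ n C 2) (sym (nC1≡n n)))) ⟩
    2 ^ (n C 1 + n C 2)
      ≡⟨ cong (2 ^_) (nCk+nC[k+1]≡[n+1]C[k+1] n 1) ⟩
    2 ^ (suc n C 2) ∎

  ∑G-const : ∀ n c → ∑G {n} (λ _ → c) ≡ 2 ^ (n C 2) * c
  ∑G-const n c = trans (sumOver-const (allGraphs n) c) (cong (_* c) (length-allGraphs n))

  count : ∀ {n} → Family n → ℕ
  count F = ∑G (λ x → 𝟙 (F x))

  count-translate : ∀ {n} (a : Graph n) (F : Family n) → count (λ x → F (x +G a)) ≡ count F
  count-translate a F = ∑G-translate a (λ x → 𝟙 (F x))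

  count-empty : ∀ {n} (F : Family n) → (∀ x → F x ≡ false) → count F ≡ 0
  count-empty {n} F F≡false =
    trans (sumOver-cong (allGraphs n) (λ x → cong 𝟙 (F≡false x))) (trans (∑G-const n 0) (*-zeroʳ (2 ^ (n C 2))))

  _∩ᶠ_ : ∀ {n} → Family n → Family n → Family n
  (F ∩ᶠ F′) x = F x ∧ F′ x

  hyperplane : ∀ {n} → Graph n → Bool → Family n
  hyperplane ξ b x = not (x · ξ xor b)

  ∈-hyperplane : ∀ {n} {ξ x : Graph n} {b} → hyperplane ξ b x ≡ true → x · ξ ≡ b
  ∈-hyperplane {ξ = ξ} {x} {b} with x · ξ | b
  ... | true  | true  = λ _ → refl
  ... | false | false = λ _ → refl
  ... | true  | false = λ ()
  ... | false | true  = λ ()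

  hyperplane-∋ : ∀ {n} {ξ x : Graph n} {b} → x · ξ ≡ b → hyperplane ξ b x ≡ true
  hyperplane-∋ {b = b} refl = cong not (xor-same b)

  module _ {n} {ξ y : Graph n} (y·ξ≡1 : y · ξ ≡ true) where

    hyperplane-translate : ∀ b x → hyperplane ξ b (x +G y) ≡ hyperplane ξ (not b) x
    hyperplane-translate b x =
      trans (cong (λ c → not (c xor b)) (trans (·-distribʳ-+G x y ξ) (cong (x · ξ xor_) y·ξ≡1))) (by-cases (x · ξ) b)
      where
      by-cases : ∀ a b → not ((a xor true) xor b) ≡ not (a xor not b)
      by-cases true  true  = refl
      by-cases true  false = refl
      by-cases false true  = refl
      by-cases false false = refl

    count-hyperplane : ∀ b → 2 * count (hyperplane ξ b) ≡ 2 ^ (n C 2)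
    count-hyperplane b = begin
      2 * count (H b)
        ≡⟨ cong (count (H b) +_) (+-identityʳ _) ⟩
      count (H b) + count (H b)
        ≡⟨ cong (count (H b) +_) (sym (count-translate y (H b))) ⟩
      count (H b) + count (λ x → H b (x +G y))
        ≡⟨ sym (sumOver-+ (allGraphs n) _ _) ⟩
      ∑G (λ x → 𝟙 (H b x) + 𝟙 (H b (x +G y)))
        ≡⟨ sumOver-cong (allGraphs n) (λ x → cong (λ c → 𝟙 (H b x) + 𝟙 c) (hyperplane-translate b x)) ⟩
      ∑G (λ x → 𝟙 (not (x · ξ xor b)) + 𝟙 (not (x · ξ xor not b)))
        ≡⟨ sumOver-cong (allGraphs n) (λ x → one (x · ξ) b) ⟩
      ∑G {n} (λ _ → 1)
        ≡⟨ trans (∑G-const n 1) (*-identityʳ _) ⟩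
      2 ^ (n C 2) ∎
      where
      H = hyperplane ξ
      one : ∀ a b → 𝟙 (not (a xor b)) + 𝟙 (not (a xor not b)) ≡ 1
      one true  true  = refl
      one true  false = refl
      one false true  = refl
      one false false = refl

  slice : ∀ {m n} → (Graph m → Graph n) → Family n → Graph n → Family m
  slice e F x z = F (x +G e z)

  ∑G-count-slice : ∀ {m n} (e : Graph m → Graph n) (F : Family n) →
                   ∑G (λ x → count (slice e F x)) ≡ 2 ^ (m C 2) * count F
  ∑G-count-slice {m} {n} e F = begin
    ∑G (λ x → ∑G (λ z → 𝟙 (F (x +G e z))))  ≡⟨ sumOver-comm (allGraphs n) (allGraphs m) _ ⟩
    ∑G (λ z → ∑G (λ x → 𝟙 (F (x +G e z))))  ≡⟨ sumOver-cong (allGraphs m) (λ z → count-translate (e z) F) ⟩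
    ∑G {m} (λ _ → count F)                  ≡⟨ ∑G-const m (count F) ⟩
    2 ^ (m C 2) * count F                   ∎

open Counting

module Codes (𝓗 : GraphClass) where

  open import Data.Bool.Properties
    using (not-involutive; xor-inverseʳ; xor-identityʳ; not-¬; ∧-conicalˡ; ∧-conicalʳ)
  open import Data.Nat using (_+_; _*_; _^_; _≤_; z≤n)
  open import Data.Nat.Properties
    using (+-identityʳ; *-identityʳ; *-comm; *-commutativeSemigroup; *-monoʳ-≤; module ≤-Reasoning)
  open import Data.Nat.Combinatorics using (_C_)
  open import Algebra.Properties.CommutativeSemigroup *-commutativeSemigroup using (x∙yz≈y∙xz)

  ∩ᶠ-IsCode : ∀ {n} {F : Family n} (F′ : Family n) → IsCode 𝓗 F → IsCode 𝓗 (F ∩ᶠ F′)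
  ∩ᶠ-IsCode {F = F} F′ code G₁ G₂ g₁ g₂ = code G₁ G₂ (∧-conicalˡ (F G₁) (F′ G₁) g₁) (∧-conicalˡ (F G₂) (F′ G₂) g₂)

  slice-IsCode : ∀ {m n} (ι : Fin m → Fin n) (ι-injective : ∀ {a b} → ι a ≡ ι b → a ≡ b) (a₀ : Fin m) →
                 ∀ {F : Family n} → IsCode 𝓗 F → ∀ x → IsCode 𝓗 (slice (Embedding.emb ι ι-injective a₀) F x)
  slice-IsCode ι ι-injective a₀ code x z₁ z₂ f₁ f₂ (k , H , H∈𝓗 , iso) =
    code (x +G emb z₁) (x +G emb z₂) f₁ f₂ (k , H , H∈𝓗 , subst (λ G → Iso G H) (sym difference) (emb-Iso iso))
    where
    open Embedding ι ι-injective a₀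
    difference : (x +G emb z₁) +G (x +G emb z₂) ≡ emb (z₁ +G z₂)
    difference = trans (cong₂ _+G_ (+G-comm x (emb z₁)) (+G-comm x (emb z₂)))
                       (trans ([G+K]+[H+K]≡G+H (emb z₁) (emb z₂) x) (sym (emb-+G z₁ z₂)))

  module _ (even𝓗 : ∀ k (H : Graph k) → 𝓗 k H → 2 ∣ edgeCount H) where

    oddEdges⇒¬IsoToMember : ∀ {n} {G : Graph n} → oddEdges G ≡ true → ¬ IsoToMember 𝓗 G
    oddEdges⇒¬IsoToMember odd (k , H , H∈𝓗 , iso) =
      contradiction (trans (sym odd) (trans (cong oddᵇ (Iso⇒edgeCount≡ iso)) (2∣⇒oddᵇ≡false (even𝓗 k H H∈𝓗)))) λ ()

    module _ {m} {F : Family m} {p : Bool} (parity : ∀ z → F z ≡ true → oddEdges z ≡ p)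
             {e : Graph m} (odd-e : oddEdges e ≡ true) where

      shiftUnion : Family m
      shiftUnion z = F z ∨ F (z +G e)

      shifted-parity : ∀ z → F (z +G e) ≡ true → oddEdges z ≡ not p
      shifted-parity z f =
        trans (sym (not-involutive _)) (cong not (trans (sym (oddEdges-+G-odd z odd-e)) (parity (z +G e) f)))

      mixed-parity : ∀ {z z′} → F z ≡ true → F (z′ +G e) ≡ true → oddEdges (z +G z′) ≡ true
      mixed-parity {z} {z′} f f′ =
        trans (oddEdges-+G z z′) (trans (cong₂ _xor_ (parity z f) (shifted-parity z′ f′)) (xor-inverseʳ p))

      shiftUnion-IsCode : IsCode 𝓗 F → IsCode 𝓗 shiftUnion
      shiftUnion-IsCode code z₁ z₂ d₁ d₂ member with F z₁ in f₁ | F z₂ in f₂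
      ... | true  | true  = code z₁ z₂ f₁ f₂ member
      ... | true  | false = oddEdges⇒¬IsoToMember (mixed-parity f₁ d₂) member
      ... | false | true  = oddEdges⇒¬IsoToMember (trans (cong oddEdges (+G-comm z₁ z₂)) (mixed-parity f₂ d₁)) member
      ... | false | false =
        code (z₁ +G e) (z₂ +G e) d₁ d₂ (subst (IsoToMember 𝓗) (sym ([G+K]+[H+K]≡G+H z₁ z₂ e)) member)

      count-shiftUnion : count shiftUnion ≡ 2 * count F
      count-shiftUnion = begin
        ∑G (λ z → 𝟙 (F z ∨ F (z +G e)))
          ≡⟨ sumOver-cong (allGraphs m) (λ z → 𝟙-∨ (F z) (disjoint z)) ⟩
        ∑G (λ z → 𝟙 (F z) + 𝟙 (F (z +G e)))
          ≡⟨ sumOver-+ (allGraphs m) _ _ ⟩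
        count F + count (λ z → F (z +G e))
          ≡⟨ cong (count F +_) (trans (count-translate e F) (sym (+-identityʳ _))) ⟩
        2 * count F ∎
        where
        open ≡-Reasoning
        disjoint : ∀ z → F z ≡ true → F (z +G e) ≡ true → ⊥
        disjoint z f f′ = not-¬ (parity z f) (shifted-parity z f′)
        𝟙-∨ : ∀ a {b} → (a ≡ true → b ≡ true → ⊥) → 𝟙 (a ∨ b) ≡ 𝟙 a + 𝟙 b
        𝟙-∨ true  {true}  a∧b = contradiction refl (λ a → a∧b a refl)
        𝟙-∨ true  {false} _   = refl
        𝟙-∨ false         _   = refl

    module Bounds {m n} (D : ℕ) (bound : ∀ (F : Family m) → IsCode 𝓗 F → count F ≤ D)
                  {𝒢 : Family n} (𝒢-code : IsCode 𝓗 𝒢) {ξ : Graph n} (S : HomogeneousSet ξ m) (a₀ : Fin m) where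

      open HomogeneousSet S
      open Embedding ι ι-injective a₀
      open ≤-Reasoning

      count-code-≤ : 2 ^ (m C 2) * count 𝒢 ≤ 2 ^ (n C 2) * D
      count-code-≤ = begin
        2 ^ (m C 2) * count 𝒢
          ≡⟨ sym (∑G-count-slice emb 𝒢) ⟩
        ∑G (λ x → count (slice emb 𝒢 x))
          ≤⟨ sumOver-mono (allGraphs n) (λ x → bound _ (slice-IsCode ι ι-injective a₀ 𝒢-code x)) ⟩
        ∑G {n} (λ _ → D)
          ≡⟨ ∑G-const n D ⟩
        2 ^ (n C 2) * D ∎

      module _ (b : Bool) where

        𝒢ᵇ : Family n
        𝒢ᵇ = 𝒢 ∩ᶠ hyperplane ξ b

        slice-𝒢ᵇ-IsCode : ∀ x → IsCode 𝓗 (slice emb 𝒢ᵇ x)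
        slice-𝒢ᵇ-IsCode = slice-IsCode ι ι-injective a₀ (∩ᶠ-IsCode (hyperplane ξ b) 𝒢-code)

        ∈-slice-𝒢ᵇ : ∀ {x z} → slice emb 𝒢ᵇ x z ≡ true → x · ξ xor (colour ∧ oddEdges z) ≡ b
        ∈-slice-𝒢ᵇ {x} {z} s = trans (sym (cong (x · ξ xor_) (·-emb homogeneous z)))
                                     (trans (sym (·-distribʳ-+G x (emb z) ξ)) (∈-hyperplane {ξ = ξ} {x +G emb z} (∧-conicalʳ (𝒢 (x +G emb z)) _ s)))

        count-𝒢ᵇ-by-slices : 2 ^ (m C 2) * (2 * count 𝒢ᵇ) ≡ ∑G (λ x → 2 * count (slice emb 𝒢ᵇ x))
        count-𝒢ᵇ-by-slices = begin-equality
          2 ^ (m C 2) * (2 * count 𝒢ᵇ)           ≡⟨ x∙yz≈y∙xz (2 ^ (m C 2)) 2 (count 𝒢ᵇ) ⟩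
          2 * (2 ^ (m C 2) * count 𝒢ᵇ)           ≡⟨ cong (2 *_) (sym (∑G-count-slice emb 𝒢ᵇ)) ⟩
          2 * ∑G (λ x → count (slice emb 𝒢ᵇ x))  ≡⟨ sym (sumOver-*ˡ (allGraphs n) 2 _) ⟩
          ∑G (λ x → 2 * count (slice emb 𝒢ᵇ x))  ∎

        hyperplane-bound-clique : colour ≡ true → (e : Graph m) → oddEdges e ≡ true →
                                  2 ^ (m C 2) * (2 * count 𝒢ᵇ) ≤ 2 ^ (n C 2) * D
        hyperplane-bound-clique colour≡true e odd-e = begin
          2 ^ (m C 2) * (2 * count 𝒢ᵇ)           ≡⟨ count-𝒢ᵇ-by-slices ⟩
          ∑G (λ x → 2 * count (slice emb 𝒢ᵇ x))  ≤⟨ sumOver-mono (allGraphs n) doubled-slice-bound ⟩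
          ∑G {n} (λ _ → D)                       ≡⟨ ∑G-const n D ⟩
          2 ^ (n C 2) * D                        ∎
          where
          parity : ∀ x z → slice emb 𝒢ᵇ x z ≡ true → oddEdges z ≡ x · ξ xor b
          parity x z s = xor-solveʳ (x · ξ) (subst (λ c → x · ξ xor (c ∧ oddEdges z) ≡ b) colour≡true (∈-slice-𝒢ᵇ s))
            where
            xor-solveʳ : ∀ a {o c} → a xor o ≡ c → o ≡ a xor c
            xor-solveʳ true  {o} refl = sym (not-involutive o)
            xor-solveʳ false     refl = refl
          doubled-slice-bound : ∀ x → 2 * count (slice emb 𝒢ᵇ x) ≤ D
          doubled-slice-bound x = subst (_≤ D) (count-shiftUnion (parity x) odd-e)
                                    (bound _ (shiftUnion-IsCode (parity x) odd-e (slice-𝒢ᵇ-IsCode x)))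

        hyperplane-bound-independent : colour ≡ false → ∀ {y} → y · ξ ≡ true →
                                       2 ^ (m C 2) * (2 * count 𝒢ᵇ) ≤ 2 ^ (n C 2) * D
        hyperplane-bound-independent colour≡false y·ξ≡1 = begin
          2 ^ (m C 2) * (2 * count 𝒢ᵇ)
            ≡⟨ count-𝒢ᵇ-by-slices ⟩
          ∑G (λ x → 2 * count (slice emb 𝒢ᵇ x))
            ≤⟨ sumOver-mono (allGraphs n) (λ x → *-monoʳ-≤ 2 (slice-bound x)) ⟩
          ∑G (λ x → 2 * (D * 𝟙 (hyperplane ξ b x)))
            ≡⟨ sumOver-*ˡ (allGraphs n) 2 _ ⟩
          2 * ∑G (λ x → D * 𝟙 (hyperplane ξ b x))
            ≡⟨ cong (2 *_) (sumOver-*ˡ (allGraphs n) D _) ⟩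
          2 * (D * count (hyperplane ξ b))
            ≡⟨ x∙yz≈y∙xz 2 D _ ⟩
          D * (2 * count (hyperplane ξ b))
            ≡⟨ cong (D *_) (count-hyperplane {ξ = ξ} y·ξ≡1 b) ⟩
          D * 2 ^ (n C 2)
            ≡⟨ *-comm D _ ⟩
          2 ^ (n C 2) * D ∎
          where
          slice-bound : ∀ x → count (slice emb 𝒢ᵇ x) ≤ D * 𝟙 (hyperplane ξ b x)
          slice-bound x with hyperplane ξ b x in h
          ... | true  = subst (count (slice emb 𝒢ᵇ x) ≤_) (sym (*-identityʳ D)) (bound _ (slice-𝒢ᵇ-IsCode x))
          ... | false = subst (_≤ D * 0) (sym (count-empty _ outside)) z≤n
            where
            outside : ∀ z → slice emb 𝒢ᵇ x z ≡ false
            outside z with slice emb 𝒢ᵇ x z in s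
            ... | false = refl
            ... | true  = contradiction (trans (sym h) (hyperplane-∋ {ξ = ξ} {x} x·ξ≡b)) λ ()
              where
              x·ξ≡b : x · ξ ≡ b
              x·ξ≡b = trans (sym (xor-identityʳ (x · ξ)))
                        (subst (λ c → x · ξ xor (c ∧ oddEdges z) ≡ b) colour≡false (∈-slice-𝒢ᵇ s))

      hyperplane-bound : ∀ {y} → y · ξ ≡ true → (e : Graph m) → oddEdges e ≡ true →
                         ∀ b → 2 ^ (m C 2) * (2 * count (𝒢 ∩ᶠ hyperplane ξ b)) ≤ 2 ^ (n C 2) * D
      hyperplane-bound y·ξ≡1 e odd-e b with colour in c
      ... | true  = hyperplane-bound-clique b c e odd-e
      ... | false = hyperplane-bound-independent b c y·ξ≡1

module Expectation where

  import Data.Nat as ℕ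
  import Data.Nat.Properties as ℕ
  open import Data.Nat.Combinatorics using (_C_)
  import Data.Integer as ℤ
  open import Data.List using (List; []; _∷_; map; length)
  open import Data.List.Properties using (map-cong)
  open import Data.Rational
    using (ℚ; 0ℚ; 1ℚ; _+_; _*_; _-_; -_; _/_; _≤_; _<_; ∣_∣; toℚᵘ; Positive; NonNegative)
  open import Data.Rational.Properties
    using (+-identityˡ; +-identityʳ; +-assoc; +-inverseʳ; *-zeroˡ; *-zeroʳ; *-identityˡ; *-assoc;
           *-distribˡ-+; *-distribʳ-+; *-identityʳ; ≤-refl; ≤-trans; ≤-<-trans; <-irrefl; +-mono-≤; +-monoˡ-≤; +-monoʳ-≤; +-monoˡ-<;
           *-monoʳ-≤-nonNeg; nonNegative⁻¹; positive⁻¹; pos⇒nonNeg; pos*pos⇒pos; normalize-pos;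
           toℚᵘ-homo-+; toℚᵘ-homo-*; toℚᵘ-injective; toℚᵘ-fromℚᵘ; ∣p∣≡p∨∣p∣≡-p; module ≤-Reasoning)
  import Data.Rational.Solver as ℚ-Solver
  import Data.Integer.Solver as ℤ-Solver
  open import Data.Rational.Unnormalised as ℚᵘ using (*≡*) renaming (_≃_ to _≃ᵘ_)
  import Data.Rational.Unnormalised.Properties as ℚᵘ

  private
    variable
      A : Set

  fromℕ : ℕ → ℚ
  fromℕ zero    = 0ℚ
  fromℕ (suc k) = 1ℚ + fromℕ k

  fromℕ-+ : ∀ a b → fromℕ (a ℕ.+ b) ≡ fromℕ a + fromℕ b
  fromℕ-+ zero    b = sym (+-identityˡ (fromℕ b))
  fromℕ-+ (suc a) b = trans (cong (1ℚ +_) (fromℕ-+ a b)) (sym (+-assoc 1ℚ (fromℕ a) (fromℕ b)))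

  fromℕ-* : ∀ a b → fromℕ (a ℕ.* b) ≡ fromℕ a * fromℕ b
  fromℕ-* zero    b = sym (*-zeroˡ (fromℕ b))
  fromℕ-* (suc a) b = begin
    fromℕ (b ℕ.+ a ℕ.* b)        ≡⟨ trans (fromℕ-+ b (a ℕ.* b)) (cong (fromℕ b +_) (fromℕ-* a b)) ⟩
    fromℕ b + fromℕ a * fromℕ b  ≡⟨ solve 2 (λ a b → b :+ a :* b := (con 1ℚ :+ a) :* b) refl (fromℕ a) (fromℕ b) ⟩
    (1ℚ + fromℕ a) * fromℕ b     ∎
    where
    open ≡-Reasoning
    open ℚ-Solver.+-*-Solver

  fromℕ-nonNeg : ∀ k → 0ℚ ≤ fromℕ k
  fromℕ-nonNeg zero    = ≤-refl
  fromℕ-nonNeg (suc k) = +-mono-≤ (nonNegative⁻¹ 1ℚ) (fromℕ-nonNeg k)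

  fromℕ-mono-≤ : ∀ {a b} → a ℕ.≤ b → fromℕ a ≤ fromℕ b
  fromℕ-mono-≤ {a} a≤b with ℕ.m≤n⇒∃[o]m+o≡n a≤b
  ... | d , refl = subst (_≤ fromℕ (a ℕ.+ d)) (+-identityʳ (fromℕ a))
                     (subst (fromℕ a + 0ℚ ≤_) (sym (fromℕ-+ a d)) (+-monoʳ-≤ (fromℕ a) (fromℕ-nonNeg d)))

  fromℕ-cancel-≤ : ∀ {a b} → fromℕ a ≤ fromℕ b → a ℕ.≤ b
  fromℕ-cancel-≤ {a} {b} fa≤fb with a ℕ.≤? b
  ... | yes a≤b = a≤b
  ... | no  a≰b = contradiction (≤-<-trans (≤-trans (fromℕ-mono-≤ (ℕ.≰⇒> a≰b)) fa≤fb) fb<f[1+b]) (<-irrefl refl)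
    where
    fb<f[1+b] : fromℕ b < fromℕ (suc b)
    fb<f[1+b] = subst (_< 1ℚ + fromℕ b) (+-identityˡ (fromℕ b)) (+-monoˡ-< (fromℕ b) (positive⁻¹ 1ℚ))

  toℚᵘ-fromℕ : ∀ k → toℚᵘ (fromℕ k) ≃ᵘ ℚᵘ.mkℚᵘ (ℤ.+ k) 0
  toℚᵘ-fromℕ zero    = *≡* refl
  toℚᵘ-fromℕ (suc k) =
    ℚᵘ.≃-trans (toℚᵘ-homo-+ 1ℚ (fromℕ k)) (ℚᵘ.≃-trans (ℚᵘ.+-congʳ ℚᵘ.1ℚᵘ (toℚᵘ-fromℕ k)) (*≡* (
      solve 1 (λ x → (con (ℤ.+ 1) :* con (ℤ.+ 1) :+ x :* con (ℤ.+ 1)) :* con (ℤ.+ 1)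
                  := (con (ℤ.+ 1) :+ x) :* (con (ℤ.+ 1) :* con (ℤ.+ 1))) refl (ℤ.+ k))))
    where open ℤ-Solver.+-*-Solver

  fromℕ-*-inverse : ∀ d .{{_ : ℕ.NonZero d}} → fromℕ d * ((ℤ.+ 1) / d) ≡ 1ℚ
  fromℕ-*-inverse (suc d) = toℚᵘ-injective (ℚᵘ.≃-trans (toℚᵘ-homo-* (fromℕ (suc d)) ((ℤ.+ 1) / suc d))
    (ℚᵘ.≃-trans (ℚᵘ.*-cong (toℚᵘ-fromℕ (suc d)) (toℚᵘ-fromℚᵘ (ℚᵘ.mkℚᵘ (ℤ.+ 1) d))) (*≡* (
      solve 1 (λ x → (x :* con (ℤ.+ 1)) :* con (ℤ.+ 1) := con (ℤ.+ 1) :* (con (ℤ.+ 1) :* x)) refl (ℤ.+ suc d)))))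
    where open ℤ-Solver.+-*-Solver

  invSize-inverse : ∀ n → fromℕ (2 ℕ.^ (n C 2)) * invSize n ≡ 1ℚ
  invSize-inverse n = fromℕ-*-inverse (2 ℕ.^ (n C 2)) {{ℕ.m^n≢0 2 (n C 2)}}

  invSize-pos : ∀ n → Positive (invSize n)
  invSize-pos n = normalize-pos 1 (2 ℕ.^ (n C 2)) {{ℕ.m^n≢0 2 (n C 2)}}

  sumℚ-map-- : ∀ (xs : List A) (f g : A → ℚ) → sumℚ (map (λ x → f x - g x) xs) ≡ sumℚ (map f xs) - sumℚ (map g xs)
  sumℚ-map-- []       f g = refl
  sumℚ-map-- (x ∷ xs) f g = trans (cong (f x - g x +_) (sumℚ-map-- xs f g))
    (solve 4 (λ a b c d → (a :- b) :+ (c :- d) := (a :+ c) :- (b :+ d)) refl (f x) (g x) _ _)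
    where open ℚ-Solver.+-*-Solver

  sumℚ-map-*ˡ : ∀ (xs : List A) c (f : A → ℚ) → sumℚ (map (λ x → c * f x) xs) ≡ c * sumℚ (map f xs)
  sumℚ-map-*ˡ []       c f = sym (*-zeroʳ c)
  sumℚ-map-*ˡ (x ∷ xs) c f = trans (cong (c * f x +_) (sumℚ-map-*ˡ xs c f)) (sym (*-distribˡ-+ c (f x) _))

  sumℚ-map-fromℕ : ∀ (xs : List A) (f : A → ℕ) → sumℚ (map (λ x → fromℕ (f x)) xs) ≡ fromℕ (sumOver xs f)
  sumℚ-map-fromℕ []       f = refl
  sumℚ-map-fromℕ (x ∷ xs) f = trans (cong (fromℕ (f x) +_) (sumℚ-map-fromℕ xs f)) (sym (fromℕ-+ (f x) _))

  sumℚ-map-const : ∀ (xs : List A) c → sumℚ (map (λ _ → c) xs) ≡ fromℕ (length xs) * c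
  sumℚ-map-const []       c = sym (*-zeroˡ c)
  sumℚ-map-const (x ∷ xs) c = trans (cong (c +_) (sumℚ-map-const xs c))
    (solve 2 (λ c l → c :+ l :* c := (con 1ℚ :+ l) :* c) refl c (fromℕ (length xs)))
    where open ℚ-Solver.+-*-Solver

  module _ {n : ℕ} where

    𝔼-cong : ∀ {f g : Graph n → ℚ} → (∀ x → f x ≡ g x) → 𝔼 f ≡ 𝔼 g
    𝔼-cong f≗g = cong (λ s → sumℚ s * invSize n) (map-cong f≗g (allGraphs n))

    𝔼-- : ∀ (f g : Graph n → ℚ) → 𝔼 (λ x → f x - g x) ≡ 𝔼 f - 𝔼 g
    𝔼-- f g = trans (cong (_* invSize n) (sumℚ-map-- (allGraphs n) f g))
      (solve 3 (λ a b u → (a :- b) :* u := a :* u :- b :* u) refl (sumℚ (map f (allGraphs n))) (sumℚ (map g (allGraphs n))) (invSize n))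
      where open ℚ-Solver.+-*-Solver

    𝔼-*ˡ : ∀ c (f : Graph n → ℚ) → 𝔼 (λ x → c * f x) ≡ c * 𝔼 f
    𝔼-*ˡ c f = trans (cong (_* invSize n) (sumℚ-map-*ˡ (allGraphs n) c f)) (*-assoc c _ (invSize n))

    𝔼-const : ∀ c → 𝔼 {n} (λ _ → c) ≡ c
    𝔼-const c = begin
      sumℚ (map (λ _ → c) (allGraphs n)) * invSize n
        ≡⟨ cong (_* invSize n) (sumℚ-map-const (allGraphs n) c) ⟩
      fromℕ (length (allGraphs n)) * c * invSize n
        ≡⟨ cong (λ k → fromℕ k * c * invSize n) (length-allGraphs n) ⟩
      fromℕ N * c * invSize n
        ≡⟨ solve 3 (λ N c u → N :* c :* u := (N :* u) :* c) refl (fromℕ N) c (invSize n) ⟩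
      (fromℕ N * invSize n) * c
        ≡⟨ cong (_* c) (invSize-inverse n) ⟩
      1ℚ * c
        ≡⟨ *-identityˡ c ⟩
      c ∎
      where
      open ≡-Reasoning
      open ℚ-Solver.+-*-Solver
      N = 2 ℕ.^ (n C 2)

    𝔼-centred : ∀ (f : Graph n → ℚ) → 𝔼 (λ x → f x - 𝔼 f) ≡ 0ℚ
    𝔼-centred f = trans (𝔼-- f (λ _ → 𝔼 f)) (trans (cong (λ c → 𝔼 f - c) (𝔼-const (𝔼 f))) (+-inverseʳ (𝔼 f)))

    ℙ-count : ∀ (F : Family n) → ℙ F ≡ fromℕ (count F) * invSize n
    ℙ-count F = cong (_* invSize n)
      (trans (cong sumℚ (map-cong indicator≗ (allGraphs n))) (sumℚ-map-fromℕ (allGraphs n) (λ x → 𝟙 (F x))))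
      where
      indicator≗ : ∀ x → indicator F x ≡ fromℕ (𝟙 (F x))
      indicator≗ x with F x
      ... | true  = refl
      ... | false = refl

  count-≤⇒ℙ-≤ : ∀ m n a b → 2 ℕ.^ (m C 2) ℕ.* a ℕ.≤ 2 ℕ.^ (n C 2) ℕ.* b →
              fromℕ a * invSize n ≤ fromℕ b * invSize m
  count-≤⇒ℙ-≤ m n a b le = begin
    fromℕ a * u
      ≡⟨ sym (*-identityˡ _) ⟩
    1ℚ * (fromℕ a * u)
      ≡⟨ cong (_* (fromℕ a * u)) (sym (invSize-inverse m)) ⟩
    (fromℕ Qm * w) * (fromℕ a * u)
      ≡⟨ solve 4 (λ Q w a u → (Q :* w) :* (a :* u) := (Q :* a) :* (u :* w)) refl (fromℕ Qm) w (fromℕ a) u ⟩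
    (fromℕ Qm * fromℕ a) * (u * w)
      ≡⟨ cong (_* (u * w)) (sym (fromℕ-* Qm a)) ⟩
    fromℕ (Qm ℕ.* a) * (u * w)
      ≤⟨ *-monoʳ-≤-nonNeg (u * w) {{uw-nonNeg}} (fromℕ-mono-≤ le) ⟩
    fromℕ (Qn ℕ.* b) * (u * w)
      ≡⟨ cong (_* (u * w)) (fromℕ-* Qn b) ⟩
    (fromℕ Qn * fromℕ b) * (u * w)
      ≡⟨ solve 4 (λ Q b u w → (Q :* b) :* (u :* w) := (Q :* u) :* (b :* w)) refl (fromℕ Qn) (fromℕ b) u w ⟩
    (fromℕ Qn * u) * (fromℕ b * w)
      ≡⟨ cong (_* (fromℕ b * w)) (invSize-inverse n) ⟩
    1ℚ * (fromℕ b * w)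
      ≡⟨ *-identityˡ _ ⟩
    fromℕ b * w ∎
    where
    open ≤-Reasoning
    open ℚ-Solver.+-*-Solver
    Qm = 2 ℕ.^ (m C 2)
    Qn = 2 ℕ.^ (n C 2)
    u = invSize n
    w = invSize m
    uw-nonNeg : NonNegative (u * w)
    uw-nonNeg = pos⇒nonNeg (u * w) {{pos*pos⇒pos u {{invSize-pos n}} w {{invSize-pos m}}}}

  ℙ-double : ∀ {n} (F : Family n) → ℙ F + ℙ F ≡ fromℕ (2 ℕ.* count F) * invSize n
  ℙ-double {n} F = begin
    ℙ F + ℙ F
      ≡⟨ cong₂ _+_ (ℙ-count F) (ℙ-count F) ⟩
    fromℕ (count F) * u + fromℕ (count F) * u
      ≡⟨ sym (*-distribʳ-+ u (fromℕ (count F)) (fromℕ (count F))) ⟩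
    (fromℕ (count F) + fromℕ (count F)) * u
      ≡⟨ cong (λ k → (fromℕ (count F) + fromℕ k) * u) (sym (ℕ.+-identityʳ (count F))) ⟩
    (fromℕ (count F) + fromℕ (count F ℕ.+ 0)) * u
      ≡⟨ cong (_* u) (sym (fromℕ-+ (count F) _)) ⟩
    fromℕ (2 ℕ.* count F) * u ∎
    where
    open ≡-Reasoning
    u = invSize n

  ∣p-q∣≤r-[p+q] : ∀ p q r → p + p ≤ r → q + q ≤ r → ∣ p - q ∣ ≤ r - (p + q)
  ∣p-q∣≤r-[p+q] p q r 2p≤r 2q≤r with ∣p∣≡p∨∣p∣≡-p (p - q)
  ... | inj₁ ∣p-q∣≡p-q  = subst (_≤ r - (p + q)) (trans (e₁ p q) (sym ∣p-q∣≡p-q)) (+-monoˡ-≤ (- (p + q)) 2p≤r)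
    where
    open ℚ-Solver.+-*-Solver
    e₁ : ∀ p q → p + p - (p + q) ≡ p - q
    e₁ = solve 2 (λ p q → p :+ p :- (p :+ q) := p :- q) refl
  ... | inj₂ ∣p-q∣≡q-p = subst (_≤ r - (p + q)) (trans (e₂ p q) (sym ∣p-q∣≡q-p)) (+-monoˡ-≤ (- (p + q)) 2q≤r)
    where
    open ℚ-Solver.+-*-Solver
    e₂ : ∀ p q → q + q - (p + q) ≡ - (p - q)
    e₂ = solve 2 (λ p q → q :+ q :- (p :+ q) := :- (p :- q)) refl

open Expectation

module Fourier where

  import Data.Nat as ℕ
  import Data.Nat.Properties as ℕ
  open import Data.Rational using (ℚ; 0ℚ; 1ℚ; _+_; _*_; _-_; -_; _≤_; ∣_∣)
  open import Data.Rational.Properties using (*-distribʳ-+; *-identityʳ; +-inverseʳ; +-monoˡ-≤; module ≤-Reasoning)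
  import Data.Rational.Solver as ℚ-Solver

  sign-oddᵇ : ∀ k → sign k ≡ (if oddᵇ k then - 1ℚ else 1ℚ)
  sign-oddᵇ zero    = refl
  sign-oddᵇ (suc k) = trans (cong -_ (sign-oddᵇ k)) (neg-if (oddᵇ k))
    where
    neg-if : ∀ b → - (if b then - 1ℚ else 1ℚ) ≡ (if not b then - 1ℚ else 1ℚ)
    neg-if true  = refl
    neg-if false = refl

  fourier-emptyG : ∀ {n} (f : Graph n → ℚ) → fourier f emptyG ≡ 𝔼 f
  fourier-emptyG {n} f = 𝔼-cong λ x → begin
    f x * sign (edgeCount (x ∩G emptyG))  ≡⟨ cong (λ G → f x * sign (edgeCount G)) (∩G-zeroʳ x) ⟩
    f x * sign (edgeCount (emptyG {n}))   ≡⟨ cong (λ k → f x * sign k) (edgeCount-emptyG n) ⟩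
    f x * 1ℚ                              ≡⟨ *-identityʳ (f x) ⟩
    f x                                   ∎
    where open ≡-Reasoning

  module _ {n} (ξ : Graph n) where

    H₀ H₁ : Family n
    H₀ = hyperplane ξ false
    H₁ = hyperplane ξ true

    indicator-*-sign : ∀ (F : Family n) x →
      indicator F x * sign (edgeCount (x ∩G ξ)) ≡ indicator (F ∩ᶠ H₀) x - indicator (F ∩ᶠ H₁) x
    indicator-*-sign F x = trans (cong (indicator F x *_) (sign-oddᵇ (edgeCount (x ∩G ξ)))) (cases (F x) (x · ξ))
      where
      cases : ∀ g o → (if g then 1ℚ else 0ℚ) * (if o then - 1ℚ else 1ℚ) ≡
                      (if g ∧ not (o xor false) then 1ℚ else 0ℚ) - (if g ∧ not (o xor true) then 1ℚ else 0ℚ)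
      cases true  true  = refl
      cases true  false = refl
      cases false true  = refl
      cases false false = refl

    fourier-indicator : ∀ (F : Family n) c →
      fourier (λ x → indicator F x - c) ξ ≡ (ℙ (F ∩ᶠ H₀) - ℙ (F ∩ᶠ H₁)) - c * (ℙ H₀ - ℙ H₁)
    fourier-indicator F c = begin
      𝔼 (λ x → (indicator F x - c) * sign (edgeCount (x ∩G ξ)))  ≡⟨ 𝔼-cong pointwise ⟩
      𝔼 (λ x → A x - c * B x)                                    ≡⟨ 𝔼-- A (λ x → c * B x) ⟩
      𝔼 A - 𝔼 (λ x → c * B x)
        ≡⟨ cong₂ _-_ (𝔼-- (indicator (F ∩ᶠ H₀)) (indicator (F ∩ᶠ H₁)))
                     (trans (𝔼-*ˡ c B) (cong (c *_) (𝔼-- (indicator H₀) (indicator H₁)))) ⟩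
      (ℙ (F ∩ᶠ H₀) - ℙ (F ∩ᶠ H₁)) - c * (ℙ H₀ - ℙ H₁)            ∎
      where
      open ≡-Reasoning
      open ℚ-Solver.+-*-Solver
      A B : Graph n → ℚ
      A x = indicator (F ∩ᶠ H₀) x - indicator (F ∩ᶠ H₁) x
      B x = indicator H₀ x - indicator H₁ x
      pointwise : ∀ x → (indicator F x - c) * sign (edgeCount (x ∩G ξ)) ≡ A x - c * B x
      pointwise x = trans (solve 3 (λ a c s → (a :- c) :* s := a :* s :- c :* (con 1ℚ :* s)) refl (indicator F x) c s)
                          (cong₂ (λ p q → p - c * q) (indicator-*-sign F x) (indicator-*-sign (λ _ → true) x))
        where s = sign (edgeCount (x ∩G ξ))

    ℙ-split : ∀ (F : Family n) → ℙ F ≡ ℙ (F ∩ᶠ H₀) + ℙ (F ∩ᶠ H₁)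
    ℙ-split F = begin
      ℙ F
        ≡⟨ ℙ-count F ⟩
      fromℕ (count F) * u
        ≡⟨ cong (λ k → fromℕ k * u) count-split ⟩
      fromℕ (count (F ∩ᶠ H₀) ℕ.+ count (F ∩ᶠ H₁)) * u
        ≡⟨ cong (_* u) (fromℕ-+ (count (F ∩ᶠ H₀)) (count (F ∩ᶠ H₁))) ⟩
      (fromℕ (count (F ∩ᶠ H₀)) + fromℕ (count (F ∩ᶠ H₁))) * u
        ≡⟨ *-distribʳ-+ u (fromℕ (count (F ∩ᶠ H₀))) (fromℕ (count (F ∩ᶠ H₁))) ⟩
      fromℕ (count (F ∩ᶠ H₀)) * u + fromℕ (count (F ∩ᶠ H₁)) * u
        ≡⟨ sym (cong₂ _+_ (ℙ-count (F ∩ᶠ H₀)) (ℙ-count (F ∩ᶠ H₁))) ⟩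
      ℙ (F ∩ᶠ H₀) + ℙ (F ∩ᶠ H₁) ∎
      where
      open ≡-Reasoning
      u = invSize n
      cases : ∀ g o → 𝟙 g ≡ 𝟙 (g ∧ not (o xor false)) ℕ.+ 𝟙 (g ∧ not (o xor true))
      cases true  true  = refl
      cases true  false = refl
      cases false _     = refl
      count-split : count F ≡ count (F ∩ᶠ H₀) ℕ.+ count (F ∩ᶠ H₁)
      count-split = trans (sumOver-cong (allGraphs n) (λ x → cases (F x) (x · ξ))) (sumOver-+ (allGraphs n) _ _)

    module _ {y : Graph n} (y·ξ≡1 : y · ξ ≡ true) where

      ℙ-H₀≡ℙ-H₁ : ℙ H₀ ≡ ℙ H₁
      ℙ-H₀≡ℙ-H₁ = trans (ℙ-count H₀) (trans (cong (λ k → fromℕ k * invSize n) count≡) (sym (ℙ-count H₁)))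
        where
        count≡ : count H₀ ≡ count H₁
        count≡ = ℕ.*-cancelˡ-≡ (count H₀) (count H₁) 2
                   (trans (count-hyperplane {ξ = ξ} y·ξ≡1 false) (sym (count-hyperplane {ξ = ξ} y·ξ≡1 true)))

      fourier-centred-indicator : ∀ (F : Family n) → fourier (λ x → indicator F x - ℙ F) ξ ≡ ℙ (F ∩ᶠ H₀) - ℙ (F ∩ᶠ H₁)
      fourier-centred-indicator F = trans (fourier-indicator F (ℙ F))
        (trans (cong (λ p → (a - b) - ℙ F * (p - ℙ H₁)) ℙ-H₀≡ℙ-H₁)
               (solve 4 (λ a b c h → (a :- b) :- c :* (h :- h) := a :- b) refl a b (ℙ F) (ℙ H₁)))
        where
        open ℚ-Solver.+-*-Solver
        a = ℙ (F ∩ᶠ H₀)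
        b = ℙ (F ∩ᶠ H₁)

  ∣fourier-centred-indicator∣≤ : ∀ {n} (F : Family n) (ξ : Graph n) {t} → ℙ F ≤ t →
    (∀ {y} → y · ξ ≡ true → ∀ b → ℙ (F ∩ᶠ hyperplane ξ b) + ℙ (F ∩ᶠ hyperplane ξ b) ≤ t) →
    ∣ fourier (λ x → indicator F x - ℙ F) ξ ∣ ≤ t - ℙ F
  ∣fourier-centred-indicator∣≤ F ξ {t} ℙF≤t halves with nondegenerate ξ
  ... | inj₁ refl = begin
    ∣ fourier (λ x → indicator F x - ℙ F) emptyG ∣
      ≡⟨ cong ∣_∣ (trans (fourier-emptyG (λ x → indicator F x - ℙ F)) (𝔼-centred (indicator F))) ⟩
    0ℚ         ≡⟨ sym (+-inverseʳ (ℙ F)) ⟩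
    ℙ F - ℙ F  ≤⟨ +-monoˡ-≤ (- ℙ F) ℙF≤t ⟩
    t - ℙ F    ∎
    where open ≤-Reasoning
  ... | inj₂ (y , y·ξ≡1) =
    subst₂ (λ p q → ∣ p ∣ ≤ t - q) (sym (fourier-centred-indicator ξ y·ξ≡1 F)) (sym (ℙ-split ξ F))
      (∣p-q∣≤r-[p+q] (ℙ (F ∩ᶠ hyperplane ξ false)) (ℙ (F ∩ᶠ hyperplane ξ true)) t (halves y·ξ≡1 false) (halves y·ξ≡1 true))

open Fourier

module OptimalCodes {𝓗 : GraphClass} (even𝓗 : ∀ k (H : Graph k) → 𝓗 k H → 2 ∣ edgeCount H)
  {m n} {𝒢ₘ : Family m} (𝒢ₘ-optimal : IsOptimalCode 𝓗 m 𝒢ₘ)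
  {𝒢 : Family n} (𝒢-code : IsCode 𝓗 𝒢) {ξ : Graph n} (S : HomogeneousSet ξ m) (a₀ : Fin m) where

  import Data.Nat as ℕ
  open import Data.Rational using (_+_; _≤_)
  open import Data.Rational.Properties using (*-cancelʳ-≤-pos)

  optimal-count-≤ : ∀ F → IsCode 𝓗 F → count F ℕ.≤ count 𝒢ₘ
  optimal-count-≤ F code = fromℕ-cancel-≤
    (*-cancelʳ-≤-pos (invSize m) {{invSize-pos m}} (subst₂ _≤_ (ℙ-count F) (ℙ-count 𝒢ₘ) (proj₂ 𝒢ₘ-optimal F code)))

  open Codes.Bounds 𝓗 even𝓗 (count 𝒢ₘ) optimal-count-≤ 𝒢-code S a₀

  ℙ-code-≤ : ℙ 𝒢 ≤ ℙ 𝒢ₘ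
  ℙ-code-≤ = subst₂ _≤_ (sym (ℙ-count 𝒢)) (sym (ℙ-count 𝒢ₘ)) (count-≤⇒ℙ-≤ m n (count 𝒢) (count 𝒢ₘ) count-code-≤)

  2ℙ-hyperplane-≤ : ∀ {y} → y · ξ ≡ true → (e : Graph m) → oddEdges e ≡ true →
                    ∀ b → ℙ (𝒢 ∩ᶠ hyperplane ξ b) + ℙ (𝒢 ∩ᶠ hyperplane ξ b) ≤ ℙ 𝒢ₘ
  2ℙ-hyperplane-≤ y·ξ≡1 e odd-e b = subst₂ _≤_ (sym (ℙ-double (𝒢 ∩ᶠ hyperplane ξ b))) (sym (ℙ-count 𝒢ₘ))
    (count-≤⇒ℙ-≤ m n _ (count 𝒢ₘ) (hyperplane-bound y·ξ≡1 e odd-e b))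

open import Data.Nat using (_≤_; _<_; _^_; s≤s)
open import Data.Rational using (∣_∣; _-_) renaming (_≤_ to _≤ℚ_)

lemma3p4 : (𝓗 : GraphClass) →
    (∀ k (H : Graph k) → 𝓗 k H → (0 < edgeCount H) × (2 ∣ edgeCount H)) →
    (n m : ℕ) → 2 ≤ n → 2 ≤ m → 4 ^ m ≤ n →
    (𝒢 : Family n) → IsOptimalCode 𝓗 n 𝒢 →
    (𝒢ₘ : Family m) → IsOptimalCode 𝓗 m 𝒢ₘ →
    (ξ : Graph n) →
    ∣ fourier (λ x → indicator 𝒢 x - ℙ 𝒢) ξ ∣ ≤ℚ ℙ 𝒢ₘ - ℙ 𝒢
lemma3p4 𝓗 h𝓗 n m _ (s≤s (s≤s {n = m′} _)) 4^m≤n 𝒢 (𝒢-code , _) 𝒢ₘ 𝒢ₘ-optimal ξ =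
  ∣fourier-centred-indicator∣≤ 𝒢 ξ ℙ-code-≤
    (λ y·ξ≡1 → 2ℙ-hyperplane-≤ y·ξ≡1 (singleEdge m′) (oddEdges-singleEdge m′))
  where
  open OptimalCodes (λ k H H∈𝓗 → proj₂ (h𝓗 k H H∈𝓗)) 𝒢ₘ-optimal 𝒢-code (homogeneousSet m ξ 4^m≤n) zero
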